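{- Assume the Hadamard conjecture, i.e. that for every positive integer $t$ there exists a Hadamard matrix of order $4t$. Then for every integer $n\ge 1$, $\mathcal R(n) \ge 1/\sqrt{3n}$.
   Context: A Hadamard matrix of order $h$ is an $h\times h$ matrix with entries in $\{+1,-1\}$ whose determinant has absolute value $h^{h/2}$. For a positive integer $n$, $D(n)$ denotes the maximum of $\det M$ over all $n\times n$ matrices $M$ with entries in $\{+1,-1\}$, and $\mathcal R(n) := D(n)/n^{n/2}$. -}

module Defs where

open import Data.Nat using (ℕ; zero; suc)
open import Data.Fin using (Fin; zero; suc; punchIn)
open import Data.Integer using (ℤ; +_; -_; _+_; _*_; -1ℤ; 1ℤ)
open import Data.Product using (Σ; _×_; ∃)
open import Data.Sum using (_⊎_)
open import Relation.Binary.PropositionalEquality using (_≡_)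

Matrix : ℕ → Set
Matrix n = Fin n → Fin n → ℤ

IsPM1 : ∀ {n} → Matrix n → Set
IsPM1 {n} M = ∀ (i j : Fin n) → (M i j ≡ 1ℤ) ⊎ (M i j ≡ -1ℤ)

∑ : ∀ n → (Fin n → ℤ) → ℤ
∑ zero    f = + 0
∑ (suc n) f = f zero + ∑ n (λ i → f (suc i))

sgn : ℕ → ℤ
sgn zero          = 1ℤ
sgn (suc zero)    = -1ℤ
sgn (suc (suc k)) = sgn k

minor : ∀ {n} → Matrix (suc n) → Fin (suc n) → Matrix n
minor M j r c = M (suc r) (punchIn j c)

det : ∀ {n} → Matrix n → ℤ
det {zero}  M = 1ℤ
det {suc n} M = ∑ (suc n) (λ j → sgn (Data.Fin.toℕ j) * (M zero j * det (minor M j)))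

open import Data.Nat using (_^_; _≤_) renaming (_*_ to _*ℕ_)
open import Data.Integer using (∣_∣) renaming (_≤_ to _≤ℤ_)

-- Hadamard matrix of order h: ±1 entries and |det M| = h^(h/2),
-- stated equivalently (both sides non-negative) as |det M|^2 = h^h.
IsHadamard : ∀ {h} → Matrix h → Set
IsHadamard {h} M = IsPM1 M × (∣ det M ∣ ^ 2 ≡ h ^ h)

HadamardConjecture : Set
HadamardConjecture = ∀ (t : ℕ) → 1 ≤ t → Σ (Matrix (4 *ℕ t)) IsHadamard

-- R(n) ≥ 1/√(3n), i.e. D(n) / n^(n/2) ≥ 1/√(3n).  Since D(n) is the maximum
-- of det over the finite set of ±1 matrices, this says some ±1 matrix M has
-- det M ≥ n^(n/2)/√(3n) > 0, equivalently det M ≥ 0 and 3n·(det M)^2 ≥ n^n.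
RLowerBound : ℕ → Set
RLowerBound n = Σ (Matrix n) λ M →
  IsPM1 M × ((+ 0 ≤ℤ det M) × (n ^ n ≤ 3 *ℕ n *ℕ (∣ det M ∣ ^ 2)))

module Submission where

-- For n ≡ 0 (mod 4) a Hadamard matrix already has det² = nⁿ, and for n ≡ 3 some minor of a
-- Hadamard matrix of order n + 1 loses at most a factor n + 1.  For n ≡ 1, 2 one borders a
-- Hadamard matrix once or twice: adding to a ±1 matrix N of order n a first column c of signs
-- and a suitably signed first row makes every term of the Laplace expansion along that row
-- nonnegative, so the new determinant is ∣det N∣ + ∑ⱼ ∣c · Kⱼ∣ with Kⱼ the cofactor columns
-- of N.  Averaging over the 2ⁿ sign vectors c, Khintchine's inequality E ∣c · a∣ ≥ ‖a‖ / √3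
-- (from the second and fourth moments and Hölder) and ‖Kⱼ‖ ≥ ∣det N∣ / √n yield a c with gain
-- at least √(n / 3) ∣det N∣.  What remains are elementary estimates of powers, derived from
-- (1 + a / h)ᵏ ≤ h / (h - a k) up to finitely many small cases.

open import Defs
open import Data.Nat using (ℕ; _≤_)

module Sums where

  open import Data.Nat as ℕ using (zero; suc)
  import Data.Nat.Properties as ℕ
  open import Data.Fin using (Fin; zero; suc)
  open import Data.Integer using (ℤ; +_; -_; _+_; _*_; 0ℤ; ∣_∣)
  open import Data.Integer.Properties
  open import Data.Integer.Tactic.RingSolver using (solve-∀)
  open import Relation.Binary.PropositionalEquality

  ∑ℕ : ∀ n → (Fin n → ℕ) → ℕ
  ∑ℕ zero    f = 0
  ∑ℕ (suc n) f = f zero ℕ.+ ∑ℕ n (λ i → f (suc i))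

  ∑ℕ-cong : ∀ n {f g : Fin n → ℕ} → (∀ i → f i ≡ g i) → ∑ℕ n f ≡ ∑ℕ n g
  ∑ℕ-cong zero    f≗g = refl
  ∑ℕ-cong (suc n) f≗g = cong₂ ℕ._+_ (f≗g zero) (∑ℕ-cong n (λ i → f≗g (suc i)))

  ∑-cong : ∀ n {f g : Fin n → ℤ} → (∀ i → f i ≡ g i) → ∑ n f ≡ ∑ n g
  ∑-cong zero    f≗g = refl
  ∑-cong (suc n) f≗g = cong₂ _+_ (f≗g zero) (∑-cong n (λ i → f≗g (suc i)))

  ∑-distrib-+ : ∀ n (f g : Fin n → ℤ) → ∑ n (λ i → f i + g i) ≡ ∑ n f + ∑ n g
  ∑-distrib-+ zero    f g = refl
  ∑-distrib-+ (suc n) f g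
    rewrite ∑-distrib-+ n (λ i → f (suc i)) (λ i → g (suc i)) =
      interchange (f zero) (g zero) (∑ n (λ i → f (suc i))) (∑ n (λ i → g (suc i)))
    where
    interchange : ∀ a b x y → a + b + (x + y) ≡ a + x + (b + y)
    interchange = solve-∀

  *-distribˡ-∑ : ∀ n a (f : Fin n → ℤ) → a * ∑ n f ≡ ∑ n (λ i → a * f i)
  *-distribˡ-∑ zero    a f = *-zeroʳ a
  *-distribˡ-∑ (suc n) a f =
    trans (*-distribˡ-+ a (f zero) _) (cong (_+_ (a * f zero)) (*-distribˡ-∑ n a (λ i → f (suc i))))

  neg-distrib-∑ : ∀ n (f : Fin n → ℤ) → - ∑ n f ≡ ∑ n (λ i → - f i)
  neg-distrib-∑ zero    f = refl
  neg-distrib-∑ (suc n) f =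
    trans (neg-distrib-+ (f zero) _) (cong (_+_ (- f zero)) (neg-distrib-∑ n (λ i → f (suc i))))

  ∑-zero : ∀ n → ∑ n (λ _ → 0ℤ) ≡ 0ℤ
  ∑-zero zero    = refl
  ∑-zero (suc n) = trans (+-identityˡ _) (∑-zero n)

  ∑-comm : ∀ m n (f : Fin m → Fin n → ℤ) →
           ∑ m (λ i → ∑ n (f i)) ≡ ∑ n (λ j → ∑ m (λ i → f i j))
  ∑-comm zero    n f = sym (∑-zero n)
  ∑-comm (suc m) n f =
    trans (cong (_+_ (∑ n (f zero))) (∑-comm m n (λ i → f (suc i))))
          (sym (∑-distrib-+ n (f zero) (λ j → ∑ m (λ i → f (suc i) j))))

  pos-∑ : ∀ n (f : Fin n → ℕ) → ∑ n (λ i → + f i) ≡ + ∑ℕ n f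
  pos-∑ zero    f = refl
  pos-∑ (suc n) f =
    trans (cong (_+_ (+ f zero)) (pos-∑ n (λ i → f (suc i)))) (sym (pos-+ (f zero) _))

  ∣∑∣≤∑ℕ∣∣ : ∀ n (f : Fin n → ℤ) → ∣ ∑ n f ∣ ≤ ∑ℕ n (λ i → ∣ f i ∣)
  ∣∑∣≤∑ℕ∣∣ zero    f = ℕ.z≤n
  ∣∑∣≤∑ℕ∣∣ (suc n) f =
    ℕ.≤-trans (∣i+j∣≤∣i∣+∣j∣ (f zero) _)
              (ℕ.+-monoʳ-≤ ∣ f zero ∣ (∣∑∣≤∑ℕ∣∣ n (λ i → f (suc i))))

module Determinants where

  open import Data.Nat using (zero; suc)
  open import Data.Nat.Properties using (suc-injective)
  open import Data.Fin using (Fin; zero; suc; punchIn; toℕ; inject₁)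
  open import Data.Fin.Properties using (toℕ-inject₁)
  open import Data.Integer using (ℤ; +_; -_; _+_; _*_; 1ℤ; 0ℤ)
  open import Data.Integer.Properties
  open import Algebra.Properties.CommutativeSemigroup *-commutativeSemigroup using (x∙yz≈y∙xz)
  open import Data.Integer.Tactic.RingSolver using (solve-∀)
  open import Relation.Binary.PropositionalEquality
  open Sums

  det-cong : ∀ {n} {A B : Matrix n} → (∀ i j → A i j ≡ B i j) → det A ≡ det B
  det-cong {zero}  A≗B = refl
  det-cong {suc n} A≗B = ∑-cong (suc n) λ j →
    cong₂ (λ x y → sgn (toℕ j) * (x * y)) (A≗B zero j)
          (det-cong (λ r c → A≗B (suc r) (punchIn j c)))

  sgn-suc : ∀ k → sgn (suc k) ≡ - sgn k
  sgn-suc zero          = refl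
  sgn-suc (suc zero)    = refl
  sgn-suc (suc (suc k)) = sgn-suc k

  -- Opaque, so that det is unfolded only explicitly, one Laplace step at a time.
  opaque
    laplaceTerm : ∀ {n} → Matrix (suc n) → Fin (suc n) → ℤ
    laplaceTerm M j = sgn (toℕ j) * (M zero j * det (minor M j))

    det-laplace : ∀ {n} (M : Matrix (suc n)) → det M ≡ ∑ (suc n) (laplaceTerm M)
    det-laplace M = refl

    laplaceTerm-def : ∀ {n} (M : Matrix (suc n)) j →
                      laplaceTerm M j ≡ sgn (toℕ j) * (M zero j * det (minor M j))
    laplaceTerm-def M j = refl

  negateRow₀ : ∀ {k} → Matrix (suc k) → Matrix (suc k)
  negateRow₀ M zero    j = - M zero j
  negateRow₀ M (suc i) j = M (suc i) j

  det-negateRow₀ : ∀ {k} (M : Matrix (suc k)) → det (negateRow₀ M) ≡ - det M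
  det-negateRow₀ {k} M = begin
    det (negateRow₀ M)                     ≡⟨ det-laplace (negateRow₀ M) ⟩
    ∑ (suc k) (laplaceTerm (negateRow₀ M))  ≡⟨ ∑-cong (suc k) negated-term ⟩
    ∑ (suc k) (λ j → - laplaceTerm M j)    ≡⟨ neg-distrib-∑ (suc k) (laplaceTerm M) ⟨
    - ∑ (suc k) (laplaceTerm M)            ≡⟨ cong -_ (det-laplace M) ⟨
    - det M                                ∎
    where
    open ≡-Reasoning
    pull-neg : ∀ s a d → s * (- a * d) ≡ - (s * (a * d))
    pull-neg = solve-∀
    negated-term : ∀ j → laplaceTerm (negateRow₀ M) j ≡ - laplaceTerm M j
    negated-term j = trans (laplaceTerm-def (negateRow₀ M) j)
      (trans (pull-neg (sgn (toℕ j)) (M zero j) (det (minor M j))) (cong -_ (sym (laplaceTerm-def M j))))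

  consColumn : ∀ {m} → (Fin (suc m) → ℤ) → (Fin (suc m) → Fin m → ℤ) → Matrix (suc m)
  consColumn c R r zero    = c r
  consColumn c R r (suc k) = R r k

  δ : ∀ {m} → Fin m → Fin m → ℤ
  δ zero    zero    = 1ℤ
  δ zero    (suc _) = 0ℤ
  δ (suc _) zero    = 0ℤ
  δ (suc i) (suc r) = δ i r

  dropRow₀Column : ∀ {m} → (Fin (suc (suc m)) → Fin (suc m) → ℤ) →
                   Fin (suc m) → Fin (suc m) → Fin m → ℤ
  dropRow₀Column R j r k = R (suc r) (punchIn j k)

  det-consColumn-row₀ : ∀ {m} (c : Fin (suc (suc m)) → ℤ) R →
    det (consColumn c R) ≡
    c zero * det (λ r k → R (suc r) k) +
    ∑ (suc m) (λ j → sgn (toℕ (suc j)) * (R zero j * det (consColumn (λ r → c (suc r)) (dropRow₀Column R j))))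
  det-consColumn-row₀ {m} c R =
    trans (det-laplace (consColumn c R))
          (cong₂ _+_ (trans (laplaceTerm-def (consColumn c R) zero) (*-identityˡ _))
                     (∑-cong (suc m) λ j →
                        trans (laplaceTerm-def (consColumn c R) (suc j))
                              (cong (λ d → sgn (toℕ (suc j)) * (R zero j * d)) (det-minor j))))
    where
    det-minor : ∀ j → det (minor (consColumn c R) (suc j)) ≡
                      det (consColumn (λ r → c (suc r)) (dropRow₀Column R j))
    det-minor j = det-cong {A = minor (consColumn c R) (suc j)}
                           {B = consColumn (λ r → c (suc r)) (dropRow₀Column R j)}
                           λ { r zero → refl ; r (suc k) → refl }

  det-consColumn-zero : ∀ {m} (R : Fin (suc m) → Fin m → ℤ) → det (consColumn (λ _ → 0ℤ) R) ≡ 0ℤ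
  det-consColumn-zero {zero}  R = refl
  det-consColumn-zero {suc m} R = begin
    det (consColumn (λ _ → 0ℤ) R)          ≡⟨ det-consColumn-row₀ (λ _ → 0ℤ) R ⟩
    0ℤ * det (λ r k → R (suc r) k) + ∑ (suc m) t  ≡⟨ trans (+-identityˡ _) (∑-cong (suc m) vanish) ⟩
    ∑ (suc m) (λ _ → 0ℤ)                   ≡⟨ ∑-zero (suc m) ⟩
    0ℤ                                     ∎
    where
    open ≡-Reasoning
    t : Fin (suc m) → ℤ
    t j = sgn (toℕ (suc j)) * (R zero j * det (consColumn (λ _ → 0ℤ) (dropRow₀Column R j)))
    vanish : ∀ j → t j ≡ 0ℤ
    vanish j rewrite det-consColumn-zero (dropRow₀Column R j)
                   | *-zeroʳ (R zero j) = *-zeroʳ (sgn (toℕ (suc j)))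

  det-consColumn-δ₀ : ∀ {m} (R : Fin (suc (suc m)) → Fin (suc m) → ℤ) →
                      det (consColumn (δ zero) R) ≡ det (λ r k → R (suc r) k)
  det-consColumn-δ₀ {m} R = begin
    det (consColumn (δ zero) R)  ≡⟨ det-consColumn-row₀ (δ zero) R ⟩
    1ℤ * D₀ + S                  ≡⟨ cong₂ _+_ (*-identityˡ D₀) S≡0 ⟩
    D₀ + 0ℤ                      ≡⟨ +-identityʳ D₀ ⟩
    D₀                           ∎
    where
    open ≡-Reasoning
    D₀ = det (λ r k → R (suc r) k)
    S = ∑ (suc m) (λ j → sgn (toℕ (suc j)) * (R zero j * det (consColumn (λ _ → 0ℤ) (dropRow₀Column R j))))
    S≡0 : S ≡ 0ℤ
    S≡0 = trans (sym (trans (det-consColumn-row₀ (λ _ → 0ℤ) R) (+-identityˡ S))) (det-consColumn-zero R)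

  det-consColumn-δsuc : ∀ {m} (R : Fin (suc (suc m)) → Fin (suc m) → ℤ) i →
    det (consColumn (δ (suc i)) R) ≡
    ∑ (suc m) (λ j → sgn (toℕ (suc j)) * (R zero j * det (consColumn (δ i) (dropRow₀Column R j))))
  det-consColumn-δsuc R i = trans (det-consColumn-row₀ (δ (suc i)) R) (+-identityˡ _)

  det-consColumn : ∀ m (c : Fin (suc m) → ℤ) (R : Fin (suc m) → Fin m → ℤ) →
                   det (consColumn c R) ≡ ∑ (suc m) (λ i → c i * det (consColumn (δ i) R))
  det-consColumn zero    c R = cong (_+ + 0) (*-identityˡ (c zero * 1ℤ))
  det-consColumn (suc m) c R = begin
    det (consColumn c R)
      ≡⟨ det-consColumn-row₀ c R ⟩
    c zero * D₀ + ∑ (suc m) (λ j → s j * (R zero j * det (consColumn (λ r → c (suc r)) (dropRow₀Column R j))))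
      ≡⟨ cong (_+_ (c zero * D₀)) (∑-cong (suc m) λ j →
           cong (λ d → s j * (R zero j * d)) (det-consColumn m (λ r → c (suc r)) (dropRow₀Column R j))) ⟩
    c zero * D₀ + ∑ (suc m) (λ j → s j * (R zero j * ∑ (suc m) (λ i → c (suc i) * X i j)))
      ≡⟨ cong (_+_ (c zero * D₀)) (regroup (suc m) (suc m) s (R zero) (λ i → c (suc i)) X) ⟩
    c zero * D₀ + ∑ (suc m) (λ i → c (suc i) * ∑ (suc m) (λ j → s j * (R zero j * X i j)))
      ≡⟨ cong₂ _+_ (cong (c zero *_) (sym (det-consColumn-δ₀ R)))
                   (∑-cong (suc m) λ i → cong (c (suc i) *_) (sym (det-consColumn-δsuc R i))) ⟩
    ∑ (suc (suc m)) (λ i → c i * det (consColumn (δ i) R)) ∎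
    where
    open ≡-Reasoning
    D₀ = det (λ r k → R (suc r) k)
    s : Fin (suc m) → ℤ
    s j = sgn (toℕ (suc j))
    X : Fin (suc m) → Fin (suc m) → ℤ
    X i j = det (consColumn (δ i) (dropRow₀Column R j))
    regroup : ∀ p q (s r : Fin p → ℤ) (c : Fin q → ℤ) (x : Fin q → Fin p → ℤ) →
      ∑ p (λ j → s j * (r j * ∑ q (λ i → c i * x i j))) ≡ ∑ q (λ i → c i * ∑ p (λ j → s j * (r j * x i j)))
    regroup p q s r c x = begin
      ∑ p (λ j → s j * (r j * ∑ q (λ i → c i * x i j)))
        ≡⟨ ∑-cong p (λ j → trans (cong (s j *_) (*-distribˡ-∑ q (r j) _)) (*-distribˡ-∑ q (s j) _)) ⟩
      ∑ p (λ j → ∑ q (λ i → s j * (r j * (c i * x i j))))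
        ≡⟨ ∑-comm p q _ ⟩
      ∑ q (λ i → ∑ p (λ j → s j * (r j * (c i * x i j))))
        ≡⟨ ∑-cong q (λ i → trans (∑-cong p (λ j → shuffle (s j) (r j) (c i) (x i j)))
                                 (sym (*-distribˡ-∑ p (c i) _))) ⟩
      ∑ q (λ i → c i * ∑ p (λ j → s j * (r j * x i j))) ∎
      where
      shuffle : ∀ a b c d → a * (b * (c * d)) ≡ c * (a * (b * d))
      shuffle = solve-∀

  swapAdjacent : ∀ {m} → Fin m → Fin (suc m) → Fin (suc m)
  swapAdjacent zero    zero          = suc zero
  swapAdjacent zero    (suc zero)    = zero
  swapAdjacent zero    (suc (suc k)) = suc (suc k)
  swapAdjacent (suc p) zero          = zero
  swapAdjacent (suc p) (suc k)       = suc (swapAdjacent p k)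

  swapAdjacent-inject₁ : ∀ {m} (p : Fin m) → swapAdjacent p (inject₁ p) ≡ suc p
  swapAdjacent-inject₁ zero    = refl
  swapAdjacent-inject₁ (suc p) = cong suc (swapAdjacent-inject₁ p)

  swapAdjacent-suc : ∀ {m} (p : Fin m) → swapAdjacent p (suc p) ≡ inject₁ p
  swapAdjacent-suc zero    = refl
  swapAdjacent-suc (suc p) = cong suc (swapAdjacent-suc p)

  swapAdjacent-punchIn-inject₁ : ∀ {m} (p : Fin m) c →
                                 swapAdjacent p (punchIn (inject₁ p) c) ≡ punchIn (suc p) c
  swapAdjacent-punchIn-inject₁ zero    zero    = refl
  swapAdjacent-punchIn-inject₁ zero    (suc c) = refl
  swapAdjacent-punchIn-inject₁ (suc p) zero    = refl
  swapAdjacent-punchIn-inject₁ (suc p) (suc c) = cong suc (swapAdjacent-punchIn-inject₁ p c)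

  swapAdjacent-punchIn-suc : ∀ {m} (p : Fin m) c →
                             swapAdjacent p (punchIn (suc p) c) ≡ punchIn (inject₁ p) c
  swapAdjacent-punchIn-suc zero    zero    = refl
  swapAdjacent-punchIn-suc zero    (suc c) = refl
  swapAdjacent-punchIn-suc (suc p) zero    = refl
  swapAdjacent-punchIn-suc (suc p) (suc c) = cong suc (swapAdjacent-punchIn-suc p c)

  -- Away from the swapped pair, deleting column j turns the swap into a swap of the smaller matrix.
  data SwapPosition {n} (p : Fin (suc n)) : Fin (suc (suc n)) → Set where
    left  : SwapPosition p (inject₁ p)
    right : SwapPosition p (suc p)
    away  : ∀ {j} (p′ : Fin n) → swapAdjacent p j ≡ j →
            (∀ c → swapAdjacent p (punchIn j c) ≡ punchIn j (swapAdjacent p′ c)) →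
            SwapPosition p j

  swapPosition : ∀ {n} (p : Fin (suc n)) j → SwapPosition p j
  swapPosition         zero    zero                = left
  swapPosition         zero    (suc zero)          = right
  swapPosition {zero}  zero    (suc (suc ()))
  swapPosition {suc n} zero    (suc (suc j))       = away zero refl commutes
    where
    commutes : ∀ c → swapAdjacent zero (punchIn (suc (suc j)) c) ≡
                     punchIn (suc (suc j)) (swapAdjacent zero c)
    commutes zero          = refl
    commutes (suc zero)    = refl
    commutes (suc (suc c)) = refl
  swapPosition {suc n} (suc p) zero = away p refl (λ c → refl)
  swapPosition {suc n} (suc p) (suc j) with swapPosition p j
  ... | left  = left
  ... | right = right
  ... | away p′ fixed commutes = away (suc p′) (cong suc fixed) commutes′
    where
    commutes′ : ∀ c → swapAdjacent (suc p) (punchIn (suc j) c) ≡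
                      punchIn (suc j) (swapAdjacent (suc p′) c)
    commutes′ zero    = refl
    commutes′ (suc c) = cong suc (commutes c)

  ∑-swapAdjacent : ∀ {n} (p : Fin (suc n)) (f : Fin (suc (suc n)) → ℤ) →
                   ∑ (suc (suc n)) (λ j → f (swapAdjacent p j)) ≡ ∑ (suc (suc n)) f
  ∑-swapAdjacent zero f = exchange (f (suc zero)) (f zero) _
    where
    exchange : ∀ a b x → a + (b + x) ≡ b + (a + x)
    exchange = solve-∀
  ∑-swapAdjacent {suc n} (suc p) f = cong (_+_ (f zero)) (∑-swapAdjacent p (λ j → f (suc j)))

  swapColumns : ∀ {n} → Fin (suc n) → Matrix (suc (suc n)) → Matrix (suc (suc n))
  swapColumns p A r c = A r (swapAdjacent p c)

  laplaceTerm-swapColumns : ∀ {n} (p : Fin (suc n)) (A : Matrix (suc (suc n))) j →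
    sgn (toℕ j) * det (minor (swapColumns p A) j) ≡
    - (sgn (toℕ (swapAdjacent p j)) * det (minor A (swapAdjacent p j))) →
    laplaceTerm (swapColumns p A) j ≡ - laplaceTerm A (swapAdjacent p j)
  laplaceTerm-swapColumns p A j minors = begin
    laplaceTerm (swapColumns p A) j
      ≡⟨ laplaceTerm-def (swapColumns p A) j ⟩
    sgn (toℕ j) * (a * det (minor (swapColumns p A) j))
      ≡⟨ x∙yz≈y∙xz (sgn (toℕ j)) a _ ⟩
    a * (sgn (toℕ j) * det (minor (swapColumns p A) j))
      ≡⟨ cong (a *_) minors ⟩
    a * - (sgn (toℕ j′) * det (minor A j′))
      ≡⟨ pull-neg (sgn (toℕ j′)) a _ ⟩
    - (sgn (toℕ j′) * (a * det (minor A j′)))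
      ≡⟨ cong -_ (sym (laplaceTerm-def A j′)) ⟩
    - laplaceTerm A j′ ∎
    where
    open ≡-Reasoning
    j′ = swapAdjacent p j
    a = A zero j′
    pull-neg : ∀ s a d → a * - (s * d) ≡ - (s * (a * d))
    pull-neg = solve-∀

  det-swapColumns : ∀ {n} (p : Fin (suc n)) (A : Matrix (suc (suc n))) → det (swapColumns p A) ≡ - det A

  minors-swapColumns : ∀ {n} (p : Fin (suc n)) (A : Matrix (suc (suc n))) j → SwapPosition p j →
    sgn (toℕ j) * det (minor (swapColumns p A) j) ≡
    - (sgn (toℕ (swapAdjacent p j)) * det (minor A (swapAdjacent p j)))
  minors-swapColumns p A _ left
    rewrite swapAdjacent-inject₁ p | toℕ-inject₁ p | sgn-suc (toℕ p)
          | det-cong {A = minor (swapColumns p A) (inject₁ p)} {B = minor A (suc p)}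
                     (λ r c → cong (A (suc r)) (swapAdjacent-punchIn-inject₁ p c))
          = sym (trans (cong -_ (sym (neg-distribˡ-* (sgn (toℕ p)) _))) (neg-involutive _))
  minors-swapColumns p A _ right
    rewrite swapAdjacent-suc p | toℕ-inject₁ p | sgn-suc (toℕ p)
          | det-cong {A = minor (swapColumns p A) (suc p)} {B = minor A (inject₁ p)}
                     (λ r c → cong (A (suc r)) (swapAdjacent-punchIn-suc p c))
          = sym (neg-distribˡ-* (sgn (toℕ p)) _)
  minors-swapColumns {suc n} p A j (away p′ fixed commutes)
    rewrite fixed
          | det-cong {A = minor (swapColumns p A) j} {B = swapColumns p′ (minor A j)}
                     (λ r c → cong (A (suc r)) (commutes c))
          | det-swapColumns p′ (minor A j)
          = sym (neg-distribʳ-* (sgn (toℕ j)) _)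

  det-swapColumns {n} p A = begin
    det (swapColumns p A)
      ≡⟨ det-laplace (swapColumns p A) ⟩
    ∑ (suc (suc n)) (laplaceTerm (swapColumns p A))
      ≡⟨ ∑-cong (suc (suc n)) (λ j →
           laplaceTerm-swapColumns p A j (minors-swapColumns p A j (swapPosition p j))) ⟩
    ∑ (suc (suc n)) (λ j → - laplaceTerm A (swapAdjacent p j))
      ≡⟨ sym (neg-distrib-∑ (suc (suc n)) (λ j → laplaceTerm A (swapAdjacent p j))) ⟩
    - ∑ (suc (suc n)) (λ j → laplaceTerm A (swapAdjacent p j))
      ≡⟨ cong -_ (trans (∑-swapAdjacent p (laplaceTerm A)) (sym (det-laplace A))) ⟩
    - det A ∎
    where open ≡-Reasoning

  columnToFront : ∀ {m} → Fin (suc m) → Matrix (suc m) → Matrix (suc m)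
  columnToFront j N = consColumn (λ r → N r j) (λ r k → N r (punchIn j k))

  det-columnToFront : ∀ {m} (j : Fin (suc m)) (N : Matrix (suc m)) →
                      det (columnToFront j N) ≡ sgn (toℕ j) * det N
  det-columnToFront j N = go (toℕ j) j N refl
    where
    -- Fuel k = toℕ j: the recursive call is at inject₁ j, which is not structurally smaller.
    go : ∀ k {m} (j : Fin (suc m)) (N : Matrix (suc m)) → toℕ j ≡ k →
         det (columnToFront j N) ≡ sgn (toℕ j) * det N
    go _ zero N _ = trans (det-cong {A = columnToFront zero N} {B = N} λ { r zero → refl ; r (suc c) → refl })
                          (sym (*-identityˡ (det N)))
    go (suc k) {suc m} (suc j) N toℕj≡k = begin
      det (columnToFront (suc j) N)
        ≡⟨ det-cong {A = columnToFront (suc j) N} {B = columnToFront (inject₁ j) (swapColumns j N)}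
             (λ { r zero    → cong (N r) (sym (swapAdjacent-inject₁ j))
                ; r (suc c) → cong (N r) (sym (swapAdjacent-punchIn-inject₁ j c)) }) ⟩
      det (columnToFront (inject₁ j) (swapColumns j N))
        ≡⟨ go k (inject₁ j) (swapColumns j N) (trans (toℕ-inject₁ j) (suc-injective toℕj≡k)) ⟩
      sgn (toℕ (inject₁ j)) * det (swapColumns j N)
        ≡⟨ cong₂ _*_ (cong sgn (toℕ-inject₁ j)) (det-swapColumns j N) ⟩
      sgn (toℕ j) * - det N
        ≡⟨ sym (neg-distribʳ-* (sgn (toℕ j)) (det N)) ⟩
      - (sgn (toℕ j) * det N)
        ≡⟨ neg-distribˡ-* (sgn (toℕ j)) (det N) ⟩
      - sgn (toℕ j) * det N
        ≡⟨ cong (_* det N) (sym (sgn-suc (toℕ j))) ⟩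
      sgn (toℕ (suc j)) * det N ∎
      where open ≡-Reasoning

  -- cofactor N j i is the (i, j) cofactor of N multiplied by (-1)^j.
  cofactor : ∀ {k} → Matrix (suc k) → Fin (suc k) → Fin (suc k) → ℤ
  cofactor N j i = det (consColumn (δ i) (λ r c → N r (punchIn j c)))

  det-consColumn-cofactor : ∀ {k} (N : Matrix (suc k)) j c →
    det (consColumn c (λ r c′ → N r (punchIn j c′))) ≡ ∑ (suc k) (λ i → c i * cofactor N j i)
  det-consColumn-cofactor {k} N j c = det-consColumn k c (λ r c′ → N r (punchIn j c′))

  det-column-expansion : ∀ {k} (N : Matrix (suc k)) j →
                         ∑ (suc k) (λ i → N i j * cofactor N j i) ≡ sgn (toℕ j) * det N
  det-column-expansion N j = trans (sym (det-consColumn-cofactor N j (λ r → N r j))) (det-columnToFront j N)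

module Inequalities where

  open import Data.Nat
  open import Data.Nat.Properties
  open import Data.Fin using (Fin; zero; suc)
  open import Data.Product using (∃; _,_)
  open Sums using (∑ℕ)
  open import Data.Nat.Tactic.RingSolver using (solve-∀)
  open import Data.Sum using (inj₁; inj₂)
  open import Relation.Nullary using (yes; no; contradiction)
  open import Relation.Binary.PropositionalEquality

  m*m≤n*n⇒m≤n : ∀ m n → m * m ≤ n * n → m ≤ n
  m*m≤n*n⇒m≤n m n m*m≤n*n with m ≤? n
  ... | yes m≤n = m≤n
  ... | no  m≰n = contradiction m*m≤n*n (<⇒≱ (*-mono-< (≰⇒> m≰n) (≰⇒> m≰n)))

  m≤n⇒4*m*n≤[m+n]² : ∀ {m n} → m ≤ n → 4 * (m * n) ≤ (m + n) * (m + n)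
  m≤n⇒4*m*n≤[m+n]² {m} m≤n with m≤n⇒∃[o]m+o≡n m≤n
  ... | o , refl = subst (4 * (m * (m + o)) ≤_) (square-gap m o) (m≤m+n _ (o * o))
    where
    square-gap : ∀ m o → 4 * (m * (m + o)) + o * o ≡ (m + (m + o)) * (m + (m + o))
    square-gap = solve-∀

  4*m*n≤[m+n]² : ∀ m n → 4 * (m * n) ≤ (m + n) * (m + n)
  4*m*n≤[m+n]² m n with ≤-total m n
  ... | inj₁ m≤n = m≤n⇒4*m*n≤[m+n]² m≤n
  ... | inj₂ n≤m = subst₂ _≤_ (cong (4 *_) (*-comm n m)) (cong₂ _*_ (+-comm n m) (+-comm n m))
                          (m≤n⇒4*m*n≤[m+n]² n≤m)

  am-gm : ∀ u v w → u * u ≤ v * w → 2 * u ≤ v + w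
  am-gm u v w u²≤vw = m*m≤n*n⇒m≤n (2 * u) (v + w)
    (subst (_≤ (v + w) * (v + w)) (four-squares u) (≤-trans (*-monoʳ-≤ 4 u²≤vw) (4*m*n≤[m+n]² v w)))
    where
    four-squares : ∀ u → 4 * (u * u) ≡ 2 * u * (2 * u)
    four-squares = solve-∀

  m*[m*n]≤m*o⇒m*n≤o : ∀ m {n o} → m * (m * n) ≤ m * o → m * n ≤ o
  m*[m*n]≤m*o⇒m*n≤o zero    _  = z≤n
  m*[m*n]≤m*o⇒m*n≤o (suc m) le = *-cancelˡ-≤ (suc m) le

  -- The inductive step of the Cauchy–Schwarz inequality (∑ x)² ≤ (∑ a) (∑ b) when x² ≤ a b termwise.
  sq≤*-+ : ∀ {x₁ a₁ b₁ x₂ a₂ b₂} → x₁ * x₁ ≤ a₁ * b₁ → x₂ * x₂ ≤ a₂ * b₂ →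
           (x₁ + x₂) * (x₁ + x₂) ≤ (a₁ + a₂) * (b₁ + b₂)
  sq≤*-+ {x₁} {a₁} {b₁} {x₂} {a₂} {b₂} h₁ h₂ =
    subst₂ _≤_ (expand-lhs x₁ x₂) (expand-rhs a₁ a₂ b₁ b₂) (+-mono-≤ (+-mono-≤ h₁ cross) h₂)
    where
    cross : 2 * (x₁ * x₂) ≤ a₁ * b₂ + b₁ * a₂
    cross = am-gm (x₁ * x₂) (a₁ * b₂) (b₁ * a₂)
      (subst₂ _≤_ (regroup x₁ x₁ x₂ x₂) (regroup a₁ b₁ a₂ b₂) (*-mono-≤ h₁ h₂))
      where
      regroup : ∀ a b c d → a * b * (c * d) ≡ a * d * (b * c)
      regroup = solve-∀
    expand-lhs : ∀ x₁ x₂ → x₁ * x₁ + 2 * (x₁ * x₂) + x₂ * x₂ ≡ (x₁ + x₂) * (x₁ + x₂)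
    expand-lhs = solve-∀
    expand-rhs : ∀ a₁ a₂ b₁ b₂ →
                 a₁ * b₁ + (a₁ * b₂ + b₁ * a₂) + a₂ * b₂ ≡ (a₁ + a₂) * (b₁ + b₂)
    expand-rhs = solve-∀

  ∑ℕ-cauchy-schwarz : ∀ n (y : Fin n → ℕ) → ∑ℕ n y * ∑ℕ n y ≤ n * ∑ℕ n (λ i → y i * y i)
  ∑ℕ-cauchy-schwarz zero    y = z≤n
  ∑ℕ-cauchy-schwarz (suc n) y =
    sq≤*-+ {x₁ = y zero} {a₁ = 1} {b₁ = y zero * y zero} {a₂ = n}
           (≤-reflexive (sym (*-identityˡ (y zero * y zero)))) (∑ℕ-cauchy-schwarz n (λ i → y (suc i)))

  ∑ℕ-sqrt-bound : ∀ n (L C : ℕ) (u : Fin n → ℕ) → (∀ j → L ≤ C * (u j * u j)) →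
                   n * n * L ≤ C * (∑ℕ n u * ∑ℕ n u)
  ∑ℕ-sqrt-bound zero    L C u bound = z≤n
  ∑ℕ-sqrt-bound (suc n) L C u bound =
    subst₂ _≤_ (expand-lhs n L) (expand-rhs C (u zero) U)
      (+-mono-≤ (+-mono-≤ rest (*-monoʳ-≤ 2 cross)) (bound zero))
    where
    U = ∑ℕ n (λ i → u (suc i))
    rest : n * n * L ≤ C * (U * U)
    rest = ∑ℕ-sqrt-bound n L C (λ i → u (suc i)) (λ j → bound (suc j))
    cross : n * L ≤ C * (U * u zero)
    cross = m*m≤n*n⇒m≤n (n * L) (C * (U * u zero))
      (subst₂ _≤_ (regroup-lhs n L) (regroup-rhs C U (u zero)) (*-mono-≤ rest (bound zero)))
      where
      regroup-lhs : ∀ n L → n * n * L * L ≡ n * L * (n * L)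
      regroup-lhs = solve-∀
      regroup-rhs : ∀ C U v → C * (U * U) * (C * (v * v)) ≡ C * (U * v) * (C * (U * v))
      regroup-rhs = solve-∀
    expand-lhs : ∀ n L → n * n * L + 2 * (n * L) + L ≡ suc n * suc n * L
    expand-lhs = solve-∀
    expand-rhs : ∀ C v U → C * (U * U) + 2 * (C * (U * v)) + C * (v * v) ≡ C * ((v + U) * (v + U))
    expand-rhs = solve-∀

  ∑ℕ≤n*max : ∀ k (g : Fin (suc k) → ℕ) → ∃ λ j → ∑ℕ (suc k) g ≤ suc k * g j
  ∑ℕ≤n*max zero    g = zero , ≤-refl
  ∑ℕ≤n*max (suc k) g with ∑ℕ≤n*max k (λ i → g (suc i))
  ... | j , bound with g zero ≤? g (suc j)
  ...   | yes g₀≤gⱼ = suc j , +-mono-≤ g₀≤gⱼ bound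
  ...   | no  g₀≰gⱼ = zero , +-monoʳ-≤ (g zero)
                               (≤-trans bound (*-monoʳ-≤ (suc k) (<⇒≤ (≰⇒> g₀≰gⱼ))))

module SignVectors where

  open import Data.Nat
  open import Data.Nat.Properties
  open import Data.Nat.Tactic.RingSolver using (solve-∀)
  open import Data.Fin using (Fin; zero; suc)
  open import Data.Vec.Functional using (_∷_)
  open import Data.Integer using (ℤ; 1ℤ; -1ℤ)
  open import Data.Product using (Σ; _×_; _,_)
  open import Data.Sum using (_⊎_; inj₁; inj₂)
  open import Relation.Nullary using (yes; no)
  open import Relation.Binary.PropositionalEquality
  open Sums using (∑ℕ)
  open Inequalities using (sq≤*-+; m*[m*n]≤m*o⇒m*n≤o)

  IsSign : ℤ → Set
  IsSign x = x ≡ 1ℤ ⊎ x ≡ -1ℤ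

  signSum : ∀ m → ((Fin m → ℤ) → ℕ) → ℕ
  signSum zero    f = f (λ ())
  signSum (suc m) f = signSum m (λ c → f (1ℤ ∷ c)) + signSum m (λ c → f (-1ℤ ∷ c))

  signSum-cong : ∀ m {f g : (Fin m → ℤ) → ℕ} → (∀ c → f c ≡ g c) → signSum m f ≡ signSum m g
  signSum-cong zero    f≗g = f≗g _
  signSum-cong (suc m) f≗g = cong₂ _+_ (signSum-cong m (λ c → f≗g _)) (signSum-cong m (λ c → f≗g _))

  signSum-distrib-+ : ∀ m (f g : (Fin m → ℤ) → ℕ) →
                      signSum m (λ c → f c + g c) ≡ signSum m f + signSum m g
  signSum-distrib-+ zero    f g = refl
  signSum-distrib-+ (suc m) f g
    rewrite signSum-distrib-+ m (λ c → f (1ℤ ∷ c)) (λ c → g (1ℤ ∷ c))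
          | signSum-distrib-+ m (λ c → f (-1ℤ ∷ c)) (λ c → g (-1ℤ ∷ c))
          = interchange (signSum m (λ c → f (1ℤ ∷ c))) (signSum m (λ c → g (1ℤ ∷ c)))
                        (signSum m (λ c → f (-1ℤ ∷ c))) (signSum m (λ c → g (-1ℤ ∷ c)))
    where
    interchange : ∀ a b x y → a + b + (x + y) ≡ a + x + (b + y)
    interchange = solve-∀

  signSum-zero : ∀ m → signSum m (λ _ → 0) ≡ 0
  signSum-zero zero    = refl
  signSum-zero (suc m) = cong₂ _+_ (signSum-zero m) (signSum-zero m)

  signSum-∑ℕ : ∀ m k (g : Fin k → (Fin m → ℤ) → ℕ) →
               signSum m (λ c → ∑ℕ k (λ j → g j c)) ≡ ∑ℕ k (λ j → signSum m (g j))
  signSum-∑ℕ m zero    g = signSum-zero m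
  signSum-∑ℕ m (suc k) g =
    trans (signSum-distrib-+ m (g zero) (λ c → ∑ℕ k (λ j → g (suc j) c)))
          (cong (signSum m (g zero) +_) (signSum-∑ℕ m k (λ j → g (suc j))))

  signSum-cauchy-schwarz : ∀ m (w y : (Fin m → ℤ) → ℕ) →
    signSum m (λ c → w c * y c) * signSum m (λ c → w c * y c) ≤
    signSum m w * signSum m (λ c → w c * (y c * y c))
  signSum-cauchy-schwarz zero    w y = ≤-reflexive (regroup (w _) (y _))
    where
    regroup : ∀ w y → w * y * (w * y) ≡ w * (w * (y * y))
    regroup = solve-∀
  signSum-cauchy-schwarz (suc m) w y =
    sq≤*-+ {S₊ (λ c → w c * y c)} {S₊ w} {S₊ (λ c → w c * (y c * y c))}
           {S₋ (λ c → w c * y c)} {S₋ w} {S₋ (λ c → w c * (y c * y c))}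
           (signSum-cauchy-schwarz m (λ c → w (1ℤ ∷ c)) (λ c → y (1ℤ ∷ c)))
           (signSum-cauchy-schwarz m (λ c → w (-1ℤ ∷ c)) (λ c → y (-1ℤ ∷ c)))
    where
    S₊ S₋ : ((Fin (suc m) → ℤ) → ℕ) → ℕ
    S₊ f = signSum m (λ c → f (1ℤ ∷ c))
    S₋ f = signSum m (λ c → f (-1ℤ ∷ c))

  -- Hölder, from the Cauchy–Schwarz bounds (∑ p²)² ≤ ∑ p ∑ p³ and (∑ p³)² ≤ ∑ p² ∑ p⁴.
  signSum-holder : ∀ m (p : (Fin m → ℤ) → ℕ) →
    let P₁ = signSum m p
        P₂ = signSum m (λ c → p c * p c)
        P₄ = signSum m (λ c → (p c * p c) * (p c * p c))
    in P₂ * (P₂ * P₂) ≤ P₁ * P₁ * P₄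
  signSum-holder m p = m*[m*n]≤m*o⇒m*n≤o P₂ (begin
    P₂ * (P₂ * (P₂ * P₂))  ≡⟨ regroup₁ P₂ ⟩
    (P₂ * P₂) * (P₂ * P₂)  ≤⟨ *-mono-≤ cs₁ cs₁ ⟩
    (P₁ * P₃) * (P₁ * P₃)  ≡⟨ regroup₂ P₁ P₃ ⟩
    P₁ * P₁ * (P₃ * P₃)    ≤⟨ *-monoʳ-≤ (P₁ * P₁) cs₂ ⟩
    P₁ * P₁ * (P₂ * P₄)    ≡⟨ regroup₃ P₁ P₂ P₄ ⟩
    P₂ * (P₁ * P₁ * P₄)    ∎)
    where
    open ≤-Reasoning
    P₁ = signSum m p
    P₂ = signSum m (λ c → p c * p c)
    P₃ = signSum m (λ c → p c * (p c * p c))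
    P₄ = signSum m (λ c → (p c * p c) * (p c * p c))
    cs₁ : P₂ * P₂ ≤ P₁ * P₃
    cs₁ = signSum-cauchy-schwarz m p p
    cs₂ : P₃ * P₃ ≤ P₂ * P₄
    cs₂ = subst (λ x → x * x ≤ P₂ * P₄) (signSum-cong m (λ c → *-assoc (p c) (p c) (p c)))
                (signSum-cauchy-schwarz m (λ c → p c * p c) p)
    regroup₁ : ∀ x → x * (x * (x * x)) ≡ (x * x) * (x * x)
    regroup₁ = solve-∀
    regroup₂ : ∀ a b → (a * b) * (a * b) ≡ a * a * (b * b)
    regroup₂ = solve-∀
    regroup₃ : ∀ a b c → a * a * (b * c) ≡ b * (a * a * c)
    regroup₃ = solve-∀

  m*n+m*n≡2*m*n : ∀ m n → m * n + m * n ≡ 2 * m * n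
  m*n+m*n≡2*m*n = solve-∀

  signSum≤2^m*max : ∀ m (f : (Fin m → ℤ) → ℕ) →
                    Σ (Fin m → ℤ) λ c → (∀ i → IsSign (c i)) × (signSum m f ≤ 2 ^ m * f c)
  signSum≤2^m*max zero    f = (λ ()) , (λ ()) , ≤-reflexive (sym (+-identityʳ _))
  signSum≤2^m*max (suc m) f
    with signSum≤2^m*max m (λ c → f (1ℤ ∷ c)) | signSum≤2^m*max m (λ c → f (-1ℤ ∷ c))
  ... | c₊ , c₊-sign , bound₊ | c₋ , c₋-sign , bound₋ with f (1ℤ ∷ c₊) ≤? f (-1ℤ ∷ c₋)
  ...   | yes f₊≤f₋ = -1ℤ ∷ c₋ , (λ { zero → inj₂ refl ; (suc i) → c₋-sign i }) ,
          ≤-trans (+-mono-≤ (≤-trans bound₊ (*-monoʳ-≤ (2 ^ m) f₊≤f₋)) bound₋)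
                  (≤-reflexive (m*n+m*n≡2*m*n (2 ^ m) _))
  ...   | no  f₊≰f₋ = 1ℤ ∷ c₊ , (λ { zero → inj₁ refl ; (suc i) → c₊-sign i }) ,
          ≤-trans (+-mono-≤ bound₊ (≤-trans bound₋ (*-monoʳ-≤ (2 ^ m) (<⇒≤ (≰⇒> f₊≰f₋)))))
                  (≤-reflexive (m*n+m*n≡2*m*n (2 ^ m) _))

module Moments where

  open import Data.Nat as ℕ using (zero; suc; _^_)
  open import Data.Fin using (Fin; zero; suc)
  open import Data.Vec.Functional using (_∷_)
  open import Data.Integer using (ℤ; +_; _+_; _*_; 1ℤ; -1ℤ)
  open import Data.Integer.Properties
  open import Data.Integer.Tactic.RingSolver using (solve-∀)
  open import Relation.Binary.PropositionalEquality
  open Sums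
  open SignVectors using (signSum)

  signSumℤ : ∀ m → ((Fin m → ℤ) → ℤ) → ℤ
  signSumℤ zero    f = f (λ ())
  signSumℤ (suc m) f = signSumℤ m (λ c → f (1ℤ ∷ c)) + signSumℤ m (λ c → f (-1ℤ ∷ c))

  pos-signSum : ∀ m (f : (Fin m → ℤ) → ℕ) → + signSum m f ≡ signSumℤ m (λ c → + f c)
  pos-signSum zero    f = refl
  pos-signSum (suc m) f =
    trans (pos-+ (signSum m (λ c → f (1ℤ ∷ c))) _)
          (cong₂ _+_ (pos-signSum m (λ c → f (1ℤ ∷ c))) (pos-signSum m (λ c → f (-1ℤ ∷ c))))

  signSumℤ-cong : ∀ m {f g : (Fin m → ℤ) → ℤ} → (∀ c → f c ≡ g c) → signSumℤ m f ≡ signSumℤ m g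
  signSumℤ-cong zero    f≗g = f≗g _
  signSumℤ-cong (suc m) f≗g = cong₂ _+_ (signSumℤ-cong m (λ c → f≗g _)) (signSumℤ-cong m (λ c → f≗g _))

  signSumℤ-distrib-+ : ∀ m (f g : (Fin m → ℤ) → ℤ) →
                       signSumℤ m (λ c → f c + g c) ≡ signSumℤ m f + signSumℤ m g
  signSumℤ-distrib-+ zero    f g = refl
  signSumℤ-distrib-+ (suc m) f g
    rewrite signSumℤ-distrib-+ m (λ c → f (1ℤ ∷ c)) (λ c → g (1ℤ ∷ c))
          | signSumℤ-distrib-+ m (λ c → f (-1ℤ ∷ c)) (λ c → g (-1ℤ ∷ c))
          = interchange (signSumℤ m (λ c → f (1ℤ ∷ c))) (signSumℤ m (λ c → g (1ℤ ∷ c)))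
                        (signSumℤ m (λ c → f (-1ℤ ∷ c))) (signSumℤ m (λ c → g (-1ℤ ∷ c)))
    where
    interchange : ∀ a b x y → a + b + (x + y) ≡ a + x + (b + y)
    interchange = solve-∀

  *-distribˡ-signSumℤ : ∀ m k (f : (Fin m → ℤ) → ℤ) → k * signSumℤ m f ≡ signSumℤ m (λ c → k * f c)
  *-distribˡ-signSumℤ zero    k f = refl
  *-distribˡ-signSumℤ (suc m) k f =
    trans (*-distribˡ-+ k _ _)
          (cong₂ _+_ (*-distribˡ-signSumℤ m k (λ c → f (1ℤ ∷ c)))
                     (*-distribˡ-signSumℤ m k (λ c → f (-1ℤ ∷ c))))

  signSumℤ-const : ∀ m k → signSumℤ m (λ _ → k) ≡ + (2 ^ m) * k
  signSumℤ-const zero    k = sym (*-identityˡ k)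
  signSumℤ-const (suc m) k =
    trans (cong₂ _+_ (signSumℤ-const m k) (signSumℤ-const m k))
          (trans (double (+ (2 ^ m)) k) (cong (_* k) (sym (pos-* 2 (2 ^ m)))))
    where
    double : ∀ t k → t * k + t * k ≡ + 2 * t * k
    double = solve-∀

  infix 8 _·_
  _·_ : ∀ {m} → (Fin m → ℤ) → (Fin m → ℤ) → ℤ
  _·_ {m} c a = ∑ m (λ i → c i * a i)

  second-moment : ∀ m (a : Fin m → ℤ) → signSumℤ m (λ c → c · a * c · a) ≡ + (2 ^ m) * (a · a)
  second-moment zero    a = refl
  second-moment (suc m) a = begin
    signSumℤ m (λ c → S₊ c * S₊ c) + signSumℤ m (λ c → S₋ c * S₋ c)
      ≡⟨ sym (signSumℤ-distrib-+ m (λ c → S₊ c * S₊ c) (λ c → S₋ c * S₋ c)) ⟩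
    signSumℤ m (λ c → S₊ c * S₊ c + S₋ c * S₋ c)
      ≡⟨ signSumℤ-cong m (λ c → pointwise x (c · a′)) ⟩
    signSumℤ m (λ c → + 2 * (x * x) + + 2 * (c · a′ * c · a′))
      ≡⟨ signSumℤ-distrib-+ m (λ _ → + 2 * (x * x)) (λ c → + 2 * (c · a′ * c · a′)) ⟩
    signSumℤ m (λ _ → + 2 * (x * x)) + signSumℤ m (λ c → + 2 * (c · a′ * c · a′))
      ≡⟨ cong₂ _+_ (signSumℤ-const m _)
                   (trans (sym (*-distribˡ-signSumℤ m (+ 2) _)) (cong (+ 2 *_) (second-moment m a′))) ⟩
    T * (+ 2 * (x * x)) + + 2 * (T * (a′ · a′))
      ≡⟨ collect T x (a′ · a′) ⟩
    + 2 * T * (x * x + a′ · a′)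
      ≡⟨ cong (_* (x * x + a′ · a′)) (sym (pos-* 2 (2 ^ m))) ⟩
    + (2 ^ suc m) * (a · a) ∎
    where
    open ≡-Reasoning
    x = a zero
    a′ : Fin m → ℤ
    a′ i = a (suc i)
    T = + (2 ^ m)
    S₊ S₋ : (Fin m → ℤ) → ℤ
    S₊ c = (1ℤ ∷ c) · a
    S₋ c = (-1ℤ ∷ c) · a
    pointwise : ∀ x s → (1ℤ * x + s) * (1ℤ * x + s) + (-1ℤ * x + s) * (-1ℤ * x + s) ≡
                        + 2 * (x * x) + + 2 * (s * s)
    pointwise = solve-∀
    collect : ∀ t x A → t * (+ 2 * (x * x)) + + 2 * (t * A) ≡ + 2 * t * (x * x + A)
    collect = solve-∀

  fourth-moment-step : ∀ m (a : Fin (suc m) → ℤ) →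
    let x² = a zero * a zero
        a′ : Fin m → ℤ
        a′ i = a (suc i)
    in signSumℤ (suc m) (λ c → (c · a * c · a) * (c · a * c · a)) ≡
       + (2 ^ m) * (+ 2 * (x² * x²)) + + 12 * x² * (+ (2 ^ m) * (a′ · a′)) +
       + 2 * signSumℤ m (λ c → (c · a′ * c · a′) * (c · a′ * c · a′))
  fourth-moment-step m a = begin
    signSumℤ m Q₊ + signSumℤ m Q₋
      ≡⟨ sym (signSumℤ-distrib-+ m Q₊ Q₋) ⟩
    signSumℤ m (λ c → Q₊ c + Q₋ c)
      ≡⟨ signSumℤ-cong m (λ c → pointwise x (c · a′)) ⟩
    signSumℤ m (λ c → + 2 * x⁴ + + 12 * x² * (c · a′ * c · a′) + + 2 * Q c)
      ≡⟨ signSumℤ-distrib-+ m (λ c → + 2 * x⁴ + + 12 * x² * (c · a′ * c · a′)) (λ c → + 2 * Q c) ⟩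
    signSumℤ m (λ c → + 2 * x⁴ + + 12 * x² * (c · a′ * c · a′)) + signSumℤ m (λ c → + 2 * Q c)
      ≡⟨ cong (_+ signSumℤ m (λ c → + 2 * Q c))
              (signSumℤ-distrib-+ m (λ _ → + 2 * x⁴) (λ c → + 12 * x² * (c · a′ * c · a′))) ⟩
    signSumℤ m (λ _ → + 2 * x⁴) + signSumℤ m (λ c → + 12 * x² * (c · a′ * c · a′)) +
      signSumℤ m (λ c → + 2 * Q c)
      ≡⟨ cong₂ _+_ (cong₂ _+_ (signSumℤ-const m (+ 2 * x⁴))
                              (trans (sym (*-distribˡ-signSumℤ m (+ 12 * x²) (λ c → c · a′ * c · a′)))
                                     (cong (+ 12 * x² *_) (second-moment m a′))))
                   (sym (*-distribˡ-signSumℤ m (+ 2) Q)) ⟩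
    T * (+ 2 * x⁴) + + 12 * x² * (T * (a′ · a′)) + + 2 * signSumℤ m Q ∎
    where
    open ≡-Reasoning
    x = a zero
    x² = x * x
    x⁴ = x² * x²
    a′ : Fin m → ℤ
    a′ i = a (suc i)
    T = + (2 ^ m)
    Q : (Fin m → ℤ) → ℤ
    Q c = (c · a′ * c · a′) * (c · a′ * c · a′)
    Q₊ Q₋ : (Fin m → ℤ) → ℤ
    Q₊ c = ((1ℤ ∷ c) · a * (1ℤ ∷ c) · a) * ((1ℤ ∷ c) · a * (1ℤ ∷ c) · a)
    Q₋ c = ((-1ℤ ∷ c) · a * (-1ℤ ∷ c) · a) * ((-1ℤ ∷ c) · a * (-1ℤ ∷ c) · a)
    pointwise : ∀ x s →
      ((1ℤ * x + s) * (1ℤ * x + s)) * ((1ℤ * x + s) * (1ℤ * x + s)) +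
      ((-1ℤ * x + s) * (-1ℤ * x + s)) * ((-1ℤ * x + s) * (-1ℤ * x + s))
      ≡ + 2 * ((x * x) * (x * x)) + + 12 * (x * x) * (s * s) + + 2 * ((s * s) * (s * s))
    pointwise = solve-∀

  fourth-moment : ∀ m (a : Fin m → ℤ) →
    signSumℤ m (λ c → (c · a * c · a) * (c · a * c · a)) +
    + (2 ^ m) * (+ 2 * ∑ m (λ i → (a i * a i) * (a i * a i)))
    ≡ + (2 ^ m) * (+ 3 * (a · a * a · a))
  fourth-moment zero    a = refl
  fourth-moment (suc m) a = begin
    signSumℤ (suc m) (λ c → (c · a * c · a) * (c · a * c · a)) + T′ * (+ 2 * (x⁴ + B))
      ≡⟨ cong₂ _+_ (fourth-moment-step m a) (cong (_* (+ 2 * (x⁴ + B))) T′≡2T) ⟩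
    T * (+ 2 * x⁴) + + 12 * x² * (T * A) + + 2 * q + + 2 * T * (+ 2 * (x⁴ + B))
      ≡⟨ split T x² A B q ⟩
    + 2 * (q + T * (+ 2 * B)) + R
      ≡⟨ cong (λ z → + 2 * z + R) (fourth-moment m a′) ⟩
    + 2 * (T * (+ 3 * (A * A))) + R
      ≡⟨ collect T x² A ⟩
    + 2 * T * (+ 3 * ((x² + A) * (x² + A)))
      ≡⟨ cong (_* (+ 3 * ((x² + A) * (x² + A)))) T′≡2T ⟨
    T′ * (+ 3 * (a · a * a · a)) ∎
    where
    open ≡-Reasoning
    x² = a zero * a zero
    x⁴ = x² * x²
    a′ : Fin m → ℤ
    a′ i = a (suc i)
    A = a′ · a′
    B = ∑ m (λ i → (a′ i * a′ i) * (a′ i * a′ i))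
    q = signSumℤ m (λ c → (c · a′ * c · a′) * (c · a′ * c · a′))
    T = + (2 ^ m)
    T′ = + (2 ^ suc m)
    T′≡2T : T′ ≡ + 2 * T
    T′≡2T = pos-* 2 (2 ^ m)
    R = T * (+ 2 * x⁴) + + 12 * x² * (T * A) + + 2 * T * (+ 2 * x⁴)
    split : ∀ T y A B q → T * (+ 2 * (y * y)) + + 12 * y * (T * A) + + 2 * q + + 2 * T * (+ 2 * (y * y + B)) ≡
                          + 2 * (q + T * (+ 2 * B)) + (T * (+ 2 * (y * y)) + + 12 * y * (T * A) + + 2 * T * (+ 2 * (y * y)))
    split = solve-∀
    collect : ∀ T y A → + 2 * (T * (+ 3 * (A * A))) + (T * (+ 2 * (y * y)) + + 12 * y * (T * A) + + 2 * T * (+ 2 * (y * y)))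
                        ≡ + 2 * T * (+ 3 * ((y + A) * (y + A)))
    collect = solve-∀

module Khintchine where

  open import Data.Nat
  open import Data.Nat.Properties
  open import Data.Nat.Tactic.RingSolver using (solve-∀)
  open import Data.Fin using (Fin)
  open import Data.Integer as ℤ using (ℤ; +_; -[1+_]; ∣_∣)
  import Data.Integer.Properties as ℤ
  open import Relation.Nullary using (yes; no)
  open import Relation.Binary.PropositionalEquality
  open Sums
  open SignVectors
  open Moments using (pos-signSum; signSumℤ-cong; _·_; second-moment; fourth-moment)

  pos-∣∣² : ∀ x → + (∣ x ∣ * ∣ x ∣) ≡ x ℤ.* x
  pos-∣∣² (+ n)    = sym (ℤ.+◃n≡+n (n * n))
  pos-∣∣² -[1+ n ] = refl

  module _ {m} (a : Fin m → ℤ) where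

    ∑a² : ℕ
    ∑a² = ∑ℕ m (λ i → ∣ a i ∣ * ∣ a i ∣)

    ∑a⁴ : ℕ
    ∑a⁴ = ∑ℕ m (λ i → (∣ a i ∣ * ∣ a i ∣) * (∣ a i ∣ * ∣ a i ∣))

    absDot : (Fin m → ℤ) → ℕ
    absDot c = ∣ c · a ∣

    a·a≡+∑a² : a · a ≡ + ∑a²
    a·a≡+∑a² = trans (∑-cong m (λ i → sym (pos-∣∣² (a i)))) (pos-∑ m _)

    ∑a⁴-pos : ∑ m (λ i → (a i ℤ.* a i) ℤ.* (a i ℤ.* a i)) ≡ + ∑a⁴
    ∑a⁴-pos = trans (∑-cong m (λ i → trans (sym (cong₂ ℤ._*_ (pos-∣∣² (a i)) (pos-∣∣² (a i))))
                                          (sym (ℤ.pos-* (∣ a i ∣ * ∣ a i ∣) _))))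
                 (pos-∑ m _)

    signSum-second-moment : signSum m (λ c → absDot c * absDot c) ≡ 2 ^ m * ∑a²
    signSum-second-moment = ℤ.+-injective (begin
      + signSum m (λ c → absDot c * absDot c)                ≡⟨ pos-signSum m _ ⟩
      Moments.signSumℤ m (λ c → + (absDot c * absDot c))     ≡⟨ signSumℤ-cong m (λ c → pos-∣∣² (c · a)) ⟩
      Moments.signSumℤ m (λ c → c · a ℤ.* c · a)  ≡⟨ second-moment m a ⟩
      + (2 ^ m) ℤ.* a · a                          ≡⟨ cong (+ (2 ^ m) ℤ.*_) a·a≡+∑a² ⟩
      + (2 ^ m) ℤ.* + ∑a²                          ≡⟨ ℤ.pos-* (2 ^ m) ∑a² ⟨
      + (2 ^ m * ∑a²)                              ∎)
      where open ≡-Reasoning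

    signSum-fourth-moment : signSum m (λ c → (absDot c * absDot c) * (absDot c * absDot c)) + 2 ^ m * (2 * ∑a⁴) ≡
                            2 ^ m * (3 * (∑a² * ∑a²))
    signSum-fourth-moment = ℤ.+-injective (begin
      + (signSum m (λ c → (absDot c * absDot c) * (absDot c * absDot c)) + 2 ^ m * (2 * ∑a⁴))
        ≡⟨ ℤ.pos-+ _ (2 ^ m * (2 * ∑a⁴)) ⟩
      + signSum m (λ c → (absDot c * absDot c) * (absDot c * absDot c)) ℤ.+ + (2 ^ m * (2 * ∑a⁴))
        ≡⟨ cong₂ ℤ._+_ (trans (pos-signSum m _) (signSumℤ-cong m fourth-power))
                       (trans (ℤ.pos-* (2 ^ m) (2 * ∑a⁴))
                              (cong (+ (2 ^ m) ℤ.*_) (trans (ℤ.pos-* 2 ∑a⁴) (cong (+ 2 ℤ.*_) (sym ∑a⁴-pos))))) ⟩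
      Moments.signSumℤ m (λ c → (c · a ℤ.* c · a) ℤ.* (c · a ℤ.* c · a)) ℤ.+
        + (2 ^ m) ℤ.* (+ 2 ℤ.* ∑ m (λ i → (a i ℤ.* a i) ℤ.* (a i ℤ.* a i)))
        ≡⟨ fourth-moment m a ⟩
      + (2 ^ m) ℤ.* (+ 3 ℤ.* (a · a ℤ.* a · a))
        ≡⟨ cong (λ z → + (2 ^ m) ℤ.* (+ 3 ℤ.* (z ℤ.* z))) a·a≡+∑a² ⟩
      + (2 ^ m) ℤ.* (+ 3 ℤ.* (+ ∑a² ℤ.* + ∑a²))
        ≡⟨ sym (trans (ℤ.pos-* (2 ^ m) (3 * (∑a² * ∑a²))) (cong (+ (2 ^ m) ℤ.*_)
                 (trans (ℤ.pos-* 3 (∑a² * ∑a²)) (cong (+ 3 ℤ.*_) (ℤ.pos-* ∑a² ∑a²))))) ⟩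
      + (2 ^ m * (3 * (∑a² * ∑a²))) ∎)
      where
      open ≡-Reasoning
      fourth-power : ∀ c → + ((absDot c * absDot c) * (absDot c * absDot c)) ≡
                           (c · a ℤ.* c · a) ℤ.* (c · a ℤ.* c · a)
      fourth-power c = trans (ℤ.pos-* (absDot c * absDot c) _)
                             (cong₂ ℤ._*_ (pos-∣∣² (c · a)) (pos-∣∣² (c · a)))

  khintchine : ∀ m (a : Fin m → ℤ) →
               2 ^ m * 2 ^ m * ∑a² a ≤ 3 * (signSum m (absDot a) * signSum m (absDot a))
  khintchine m a with ∑a² a ≟ 0
  ... | yes A≡0 = subst (λ A → 2 ^ m * 2 ^ m * A ≤ 3 * (P₁ * P₁)) (sym A≡0)
                        (subst (_≤ 3 * (P₁ * P₁)) (sym (*-zeroʳ (2 ^ m * 2 ^ m))) z≤n)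
    where P₁ = signSum m (absDot a)
  ... | no  A≢0 = *-cancelˡ-≤ (T * A * A) {{>-nonZero TAA>0}} (begin
    T * A * A * (T * T * A)        ≡⟨ regroup₁ T A ⟩
    (T * A) * ((T * A) * (T * A))  ≡⟨ cong (λ P₂ → P₂ * (P₂ * P₂)) (sym (signSum-second-moment a)) ⟩
    P₂ * (P₂ * P₂)                 ≤⟨ signSum-holder m (absDot a) ⟩
    P₁ * P₁ * P₄                   ≤⟨ *-monoʳ-≤ (P₁ * P₁) P₄≤ ⟩
    P₁ * P₁ * (T * (3 * (A * A)))  ≡⟨ regroup₂ P₁ T A ⟩
    T * A * A * (3 * (P₁ * P₁))    ∎)
    where
    open ≤-Reasoning
    T = 2 ^ m
    A = ∑a² a
    P₁ = signSum m (absDot a)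
    P₂ = signSum m (λ c → absDot a c * absDot a c)
    P₄ = signSum m (λ c → (absDot a c * absDot a c) * (absDot a c * absDot a c))
    P₄≤ : P₄ ≤ T * (3 * (A * A))
    P₄≤ = subst (P₄ ≤_) (signSum-fourth-moment a) (m≤m+n P₄ _)
    TAA>0 : T * A * A > 0
    TAA>0 = *-mono-< (*-mono-< (m^n>0 2 m) (n≢0⇒n>0 A≢0)) (n≢0⇒n>0 A≢0)
    regroup₁ : ∀ T A → T * A * A * (T * T * A) ≡ (T * A) * ((T * A) * (T * A))
    regroup₁ = solve-∀
    regroup₂ : ∀ P T A → P * P * (T * (3 * (A * A))) ≡ T * A * A * (3 * (P * P))
    regroup₂ = solve-∀

module Bordering where

  open import Data.Nat
  open import Data.Nat.Properties
  open import Data.Nat.Tactic.RingSolver using (solve-∀)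
  open import Data.Fin using (Fin; zero; suc; toℕ; punchIn)
  open import Data.Integer as ℤ using (ℤ; +_; -[1+_]; ∣_∣; 1ℤ; -1ℤ)
  import Data.Integer.Properties as ℤ
  open import Algebra.Properties.CommutativeSemigroup ℤ.*-commutativeSemigroup using (x∙yz≈y∙xz)
  open import Data.Product using (Σ; _×_; _,_)
  open import Data.Sum using (inj₁; inj₂)
  open import Relation.Binary.PropositionalEquality
  open Sums
  open Determinants
  open Inequalities
  open SignVectors
  open Moments using (_·_)
  open Khintchine

  -- signum (+ 0) = 1, so that signum always yields a sign.
  signum : ℤ → ℤ
  signum (+ _)    = 1ℤ
  signum -[1+ _ ] = -1ℤ

  signum-isSign : ∀ x → IsSign (signum x)
  signum-isSign (+ _)    = inj₁ refl
  signum-isSign -[1+ _ ] = inj₂ refl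

  signum*x≡∣x∣ : ∀ x → signum x ℤ.* x ≡ + ∣ x ∣
  signum*x≡∣x∣ (+ n)    = ℤ.*-identityˡ (+ n)
  signum*x≡∣x∣ -[1+ n ] = ℤ.-1*i≡-i -[1+ n ]

  ∣sign∣≡1 : ∀ {x} → IsSign x → ∣ x ∣ ≡ 1
  ∣sign∣≡1 (inj₁ refl) = refl
  ∣sign∣≡1 (inj₂ refl) = refl

  ∣sign*x∣≡∣x∣ : ∀ {s} → IsSign s → ∀ x → ∣ s ℤ.* x ∣ ≡ ∣ x ∣
  ∣sign*x∣≡∣x∣ {s} s-sign x =
    trans (ℤ.abs-* s x) (trans (cong (_* ∣ x ∣) (∣sign∣≡1 s-sign)) (*-identityˡ ∣ x ∣))

  sgn-isSign : ∀ k → IsSign (sgn k)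
  sgn-isSign zero          = inj₁ refl
  sgn-isSign (suc zero)    = inj₂ refl
  sgn-isSign (suc (suc k)) = sgn-isSign k

  scaled-bound-trans : ∀ {n T d² A U} → d² ≤ n * A → T * T * A ≤ 3 * (U * U) →
                       T * T * d² ≤ 3 * n * (U * U)
  scaled-bound-trans {n} {T} {d²} {A} {U} d²≤nA T²A≤3U² = begin
    T * T * d²        ≤⟨ *-monoʳ-≤ (T * T) d²≤nA ⟩
    T * T * (n * A)   ≡⟨ regroup₁ T n A ⟩
    n * (T * T * A)   ≤⟨ *-monoʳ-≤ n T²A≤3U² ⟩
    n * (3 * (U * U)) ≡⟨ regroup₂ n (U * U) ⟩
    3 * n * (U * U)   ∎
    where
    open ≤-Reasoning
    regroup₁ : ∀ T n A → T * T * (n * A) ≡ n * (T * T * A)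
    regroup₁ = solve-∀
    regroup₂ : ∀ n x → n * (3 * x) ≡ 3 * n * x
    regroup₂ = solve-∀

  averaged-bound : ∀ {n T L G S} → 0 < n * (T * T) → n * n * (T * T * L) ≤ 3 * n * (S * S) → S ≤ T * G →
                   n * L ≤ 3 * (G * G)
  averaged-bound {n} {T} {L} {G} {S} nT²>0 n²T²L≤3nS² S≤TG = *-cancelˡ-≤ (n * (T * T)) {{>-nonZero nT²>0}} (begin
    n * (T * T) * (n * L)       ≡⟨ regroup₁ n T L ⟩
    n * n * (T * T * L)         ≤⟨ n²T²L≤3nS² ⟩
    3 * n * (S * S)             ≤⟨ *-monoʳ-≤ (3 * n) (*-mono-≤ S≤TG S≤TG) ⟩
    3 * n * (T * G * (T * G))   ≡⟨ regroup₂ n T G ⟩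
    n * (T * T) * (3 * (G * G)) ∎)
    where
    open ≤-Reasoning
    regroup₁ : ∀ n t x → n * (t * t) * (n * x) ≡ n * n * (t * t * x)
    regroup₁ = solve-∀
    regroup₂ : ∀ n t g → 3 * n * (t * g * (t * g)) ≡ n * (t * t) * (3 * (g * g))
    regroup₂ = solve-∀

  module _ {k} (N : Matrix (suc k)) where

    -- Expanding the bordered matrix along its first row, the top-left entry contributes
    -- ∣ det N ∣ and the entry above column j contributes ∣ c · cofactor N j ∣.
    bordered : (Fin (suc k) → ℤ) → Matrix (suc (suc k))
    bordered c zero    zero    = signum (det N)
    bordered c zero    (suc j) = signum (sgn (toℕ (suc j)) ℤ.* c · cofactor N j)
    bordered c (suc r) zero    = c r
    bordered c (suc r) (suc j) = N r j

    borderGain : (Fin (suc k) → ℤ) → ℕ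
    borderGain c = ∑ℕ (suc k) (λ j → absDot (cofactor N j) c)

    bordered-isPM1 : IsPM1 N → ∀ {c} → (∀ i → IsSign (c i)) → IsPM1 (bordered c)
    bordered-isPM1 N-pm c-sign zero    zero    = signum-isSign _
    bordered-isPM1 N-pm c-sign zero    (suc j) = signum-isSign _
    bordered-isPM1 N-pm c-sign (suc r) zero    = c-sign r
    bordered-isPM1 N-pm c-sign (suc r) (suc j) = N-pm r j

    det-bordered : ∀ c → det (bordered c) ≡ + (∣ det N ∣ + borderGain c)
    det-bordered c = begin
      det (bordered c)
        ≡⟨ det-laplace (bordered c) ⟩
      laplaceTerm (bordered c) zero ℤ.+ ∑ (suc k) (λ j → laplaceTerm (bordered c) (suc j))
        ≡⟨ cong₂ ℤ._+_ corner (trans (∑-cong (suc k) edge) (pos-∑ (suc k) (λ j → absDot (cofactor N j) c))) ⟩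
      + ∣ det N ∣ ℤ.+ + borderGain c
        ≡⟨ ℤ.pos-+ ∣ det N ∣ (borderGain c) ⟨
      + (∣ det N ∣ + borderGain c) ∎
      where
      open ≡-Reasoning
      corner : laplaceTerm (bordered c) zero ≡ + ∣ det N ∣
      corner = begin
        laplaceTerm (bordered c) zero
          ≡⟨ laplaceTerm-def (bordered c) zero ⟩
        1ℤ ℤ.* (signum (det N) ℤ.* det (minor (bordered c) zero))
          ≡⟨ ℤ.*-identityˡ _ ⟩
        signum (det N) ℤ.* det (minor (bordered c) zero)
          ≡⟨ cong (signum (det N) ℤ.*_) (det-cong {A = minor (bordered c) zero} {B = N} (λ r c → refl)) ⟩
        signum (det N) ℤ.* det N
          ≡⟨ signum*x≡∣x∣ (det N) ⟩
        + ∣ det N ∣ ∎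
      edge : ∀ j → laplaceTerm (bordered c) (suc j) ≡ + ∣ c · cofactor N j ∣
      edge j = begin
        laplaceTerm (bordered c) (suc j)
          ≡⟨ laplaceTerm-def (bordered c) (suc j) ⟩
        s ℤ.* (signum (s ℤ.* x) ℤ.* det (minor (bordered c) (suc j)))
          ≡⟨ cong (λ d → s ℤ.* (signum (s ℤ.* x) ℤ.* d)) det-minor ⟩
        s ℤ.* (signum (s ℤ.* x) ℤ.* x)
          ≡⟨ x∙yz≈y∙xz s (signum (s ℤ.* x)) x ⟩
        signum (s ℤ.* x) ℤ.* (s ℤ.* x)
          ≡⟨ signum*x≡∣x∣ (s ℤ.* x) ⟩
        + ∣ s ℤ.* x ∣
          ≡⟨ cong +_ (∣sign*x∣≡∣x∣ (sgn-isSign (toℕ (suc j))) x) ⟩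
        + ∣ x ∣ ∎
        where
        s = sgn (toℕ (suc j))
        x = c · cofactor N j
        det-minor : det (minor (bordered c) (suc j)) ≡ x
        det-minor = trans (det-cong {A = minor (bordered c) (suc j)}
                                    {B = consColumn c (λ r c′ → N r (punchIn j c′))}
                                    (λ { r zero → refl ; r (suc c′) → refl }))
                          (det-consColumn-cofactor N j c)

    cofactor-bound : IsPM1 N → ∀ j → ∣ det N ∣ * ∣ det N ∣ ≤ suc k * ∑a² (cofactor N j)
    cofactor-bound N-pm j =
      ≤-trans (*-mono-≤ d≤∑ d≤∑) (∑ℕ-cauchy-schwarz (suc k) (λ i → ∣ cofactor N j i ∣))
      where
      open ≤-Reasoning
      d≤∑ : ∣ det N ∣ ≤ ∑ℕ (suc k) (λ i → ∣ cofactor N j i ∣)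
      d≤∑ = begin
        ∣ det N ∣
          ≡⟨ ∣sign*x∣≡∣x∣ (sgn-isSign (toℕ j)) (det N) ⟨
        ∣ sgn (toℕ j) ℤ.* det N ∣
          ≡⟨ cong ∣_∣ (det-column-expansion N j) ⟨
        ∣ ∑ (suc k) (λ i → N i j ℤ.* cofactor N j i) ∣
          ≤⟨ ∣∑∣≤∑ℕ∣∣ (suc k) (λ i → N i j ℤ.* cofactor N j i) ⟩
        ∑ℕ (suc k) (λ i → ∣ N i j ℤ.* cofactor N j i ∣)
          ≡⟨ ∑ℕ-cong (suc k) (λ i → ∣sign*x∣≡∣x∣ (N-pm i j) (cofactor N j i)) ⟩
        ∑ℕ (suc k) (λ i → ∣ cofactor N j i ∣) ∎

    cofactor-signSum-bound : IsPM1 N → ∀ j →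
      2 ^ suc k * 2 ^ suc k * (∣ det N ∣ * ∣ det N ∣) ≤
      3 * suc k * (signSum (suc k) (absDot (cofactor N j)) * signSum (suc k) (absDot (cofactor N j)))
    cofactor-signSum-bound N-pm j =
      scaled-bound-trans {n = suc k} {T = 2 ^ suc k} {A = ∑a² (cofactor N j)}
                         {U = signSum (suc k) (absDot (cofactor N j))}
                         (cofactor-bound N-pm j) (khintchine (suc k) (cofactor N j))

    borderGain-bound : IsPM1 N → ∀ c → signSum (suc k) borderGain ≤ 2 ^ suc k * borderGain c →
                       suc k * (∣ det N ∣ * ∣ det N ∣) ≤ 3 * (borderGain c * borderGain c)
    borderGain-bound N-pm c total≤ =
      averaged-bound {n = suc k} {T = 2 ^ suc k} {L = ∣ det N ∣ * ∣ det N ∣} {G = borderGain c}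
                     {S = signSum (suc k) borderGain}
        (*-mono-< (z<s {k}) (*-mono-< (m^n>0 2 (suc k)) (m^n>0 2 (suc k))))
        (subst (λ S → suc k * suc k * L ≤ 3 * suc k * (S * S)) (sym total≡)
               (∑ℕ-sqrt-bound (suc k) L (3 * suc k) (λ j → signSum (suc k) (absDot (cofactor N j)))
                              (cofactor-signSum-bound N-pm)))
        total≤
      where
      L = 2 ^ suc k * 2 ^ suc k * (∣ det N ∣ * ∣ det N ∣)
      total≡ : signSum (suc k) borderGain ≡ ∑ℕ (suc k) (λ j → signSum (suc k) (absDot (cofactor N j)))
      total≡ = signSum-∑ℕ (suc k) (suc k) (λ j → absDot (cofactor N j))

  -- Opaque, like minor-bound below: both proofs branch on comparisons of determinants,
  -- and unfolding them at use sites makes typechecking blow up.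
  opaque
    bordering : ∀ {k} (N : Matrix (suc k)) → IsPM1 N →
      Σ (Matrix (suc (suc k))) λ P → IsPM1 P × Σ ℕ λ F →
        (∣ det P ∣ ≡ ∣ det N ∣ + F) × (suc k * (∣ det N ∣ * ∣ det N ∣) ≤ 3 * (F * F))
    bordering {k} N N-pm with signSum≤2^m*max (suc k) (borderGain N)
    ... | c , c-sign , total≤ =
      bordered N c , bordered-isPM1 N N-pm c-sign , borderGain N c , cong ∣_∣ (det-bordered N c) ,
      borderGain-bound N N-pm c total≤

module Estimates where

  open import Data.Nat
  open import Data.Nat.Properties
  open import Data.Nat.Tactic.RingSolver using (solve-∀)
  open import Data.Unit using (tt)
  open import Relation.Binary.PropositionalEquality
  open Inequalities using (m*m≤n*n⇒m≤n)

  pow-bound : ∀ a k c h → c + a * k ≡ h → (h + a) ^ k * c ≤ h ^ k * h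
  pow-bound a zero    c h eq = *-monoʳ-≤ 1 (subst (c ≤_) eq (m≤m+n c (a * 0)))
  pow-bound a (suc k) c h eq = begin
    (h + a) ^ suc k * c        ≡⟨ regroup₁ (h + a) ((h + a) ^ k) c ⟩
    (h + a) ^ k * ((h + a) * c) ≤⟨ *-monoʳ-≤ ((h + a) ^ k) step ⟩
    (h + a) ^ k * ((c + a) * h) ≡⟨ *-assoc ((h + a) ^ k) (c + a) h ⟨
    (h + a) ^ k * (c + a) * h   ≤⟨ *-monoˡ-≤ h (pow-bound a k (c + a) h (trans (shift c a k) eq)) ⟩
    h ^ k * h * h               ≡⟨ regroup₂ h (h ^ k) ⟩
    h ^ suc k * h               ∎
    where
    open ≤-Reasoning
    step : (h + a) * c ≤ (c + a) * h
    step = begin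
      (h + a) * c   ≡⟨ expand h a c ⟩
      c * h + a * c ≤⟨ +-monoʳ-≤ (c * h) (*-monoʳ-≤ a (subst (c ≤_) eq (m≤m+n c (a * suc k)))) ⟩
      c * h + a * h ≡⟨ *-distribʳ-+ h c a ⟨
      (c + a) * h   ∎
      where
      expand : ∀ h a c → (h + a) * c ≡ c * h + a * c
      expand = solve-∀
    regroup₁ : ∀ x y c → x * y * c ≡ y * (x * c)
    regroup₁ = solve-∀
    shift : ∀ c a k → c + a + a * k ≡ c + a * suc k
    shift = solve-∀
    regroup₂ : ∀ h y → y * h * h ≡ h * y * h
    regroup₂ = solve-∀

  [h+a]^k≤2*h^k : ∀ a k h → 0 < a * k → a * k + a * k ≡ h → (h + a) ^ k ≤ 2 * h ^ k
  [h+a]^k≤2*h^k a k h ak>0 eq = *-cancelˡ-≤ (a * k) {{>-nonZero ak>0}} (begin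
    a * k * (h + a) ^ k       ≡⟨ *-comm (a * k) ((h + a) ^ k) ⟩
    (h + a) ^ k * (a * k)     ≤⟨ pow-bound a k (a * k) h eq ⟩
    h ^ k * h                 ≡⟨ cong (h ^ k *_) eq ⟨
    h ^ k * (a * k + a * k)   ≡⟨ regroup (h ^ k) (a * k) ⟩
    a * k * (2 * h ^ k)       ∎)
    where
    open ≤-Reasoning
    regroup : ∀ x y → x * (y + y) ≡ y * (2 * x)
    regroup = solve-∀

  [h+1]^h≤4*h^h : ∀ t → (5 + 4 * t) ^ (4 + 4 * t) ≤ 4 * (4 + 4 * t) ^ (4 + 4 * t)
  [h+1]^h≤4*h^h t = begin
    n ^ h                        ≡⟨ cong (n ^_) h≡k+k ⟩
    n ^ (k + k)                  ≡⟨ ^-distribˡ-+-* n k k ⟩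
    n ^ k * n ^ k                ≤⟨ *-mono-≤ half half ⟩
    (2 * h ^ k) * (2 * h ^ k)    ≡⟨ square (h ^ k) ⟩
    4 * (h ^ k * h ^ k)          ≡⟨ cong (4 *_) (^-distribˡ-+-* h k k) ⟨
    4 * h ^ (k + k)              ≡⟨ cong (λ e → 4 * h ^ e) h≡k+k ⟨
    4 * h ^ h                    ∎
    where
    open ≤-Reasoning
    h = 4 + 4 * t
    n = 5 + 4 * t
    k = 2 + 2 * t
    h≡k+k : h ≡ k + k
    h≡k+k = halve t
      where
      halve : ∀ t → 4 + 4 * t ≡ (2 + 2 * t) + (2 + 2 * t)
      halve = solve-∀
    half : n ^ k ≤ 2 * h ^ k
    half = subst (λ x → x ^ k ≤ 2 * h ^ k) (+-comm h 1)
                 ([h+a]^k≤2*h^k 1 k h z<s (trans (cong₂ _+_ (*-identityˡ k) (*-identityˡ k)) (sym h≡k+k)))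
    square : ∀ x → 2 * x * (2 * x) ≡ 4 * (x * x)
    square = solve-∀

  [h+2]^h≤16*h^h : ∀ t → (6 + 4 * t) ^ (4 + 4 * t) ≤ 16 * (4 + 4 * t) ^ (4 + 4 * t)
  [h+2]^h≤16*h^h t = begin
    n ^ h                     ≡⟨ cong (n ^_) h≡k*4 ⟩
    n ^ (k * 4)               ≡⟨ ^-*-assoc n k 4 ⟨
    (n ^ k) ^ 4               ≤⟨ ^-monoˡ-≤ 4 quarter ⟩
    (2 * h ^ k) ^ 4           ≡⟨ fourth-power (h ^ k) ⟩
    16 * (h ^ k) ^ 4          ≡⟨ cong (16 *_) (trans (^-*-assoc h k 4) (cong (h ^_) (sym h≡k*4))) ⟩
    16 * h ^ h                ∎
    where
    open ≤-Reasoning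
    h = 4 + 4 * t
    n = 6 + 4 * t
    k = 1 + t
    h≡k*4 : h ≡ k * 4
    h≡k*4 = quadruple t
      where
      quadruple : ∀ t → 4 + 4 * t ≡ (1 + t) * 4
      quadruple = solve-∀
    quarter : n ^ k ≤ 2 * h ^ k
    quarter = subst (λ x → x ^ k ≤ 2 * h ^ k) (+-comm h 2) ([h+a]^k≤2*h^k 2 k h z<s (halves t))
      where
      halves : ∀ t → 2 * (1 + t) + 2 * (1 + t) ≡ 4 + 4 * t
      halves = solve-∀
    fourth-power : ∀ x → (2 * x) * ((2 * x) * ((2 * x) * ((2 * x) * 1))) ≡ 16 * (x * (x * (x * (x * 1))))
    fourth-power = solve-∀

  -- For t < 7 the inequality is checked by evaluation; beyond, 48 (h + 2) ≤ (h + 10) (h + 9).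
  3*[h+2]^[h+1]≤[h+10]*[h+9]*h^h : ∀ t →
    3 * (6 + 4 * t) ^ (5 + 4 * t) ≤ (14 + 4 * t) * (13 + 4 * t) * (4 + 4 * t) ^ (4 + 4 * t)
  3*[h+2]^[h+1]≤[h+10]*[h+9]*h^h 0 = ≤ᵇ⇒≤ _ _ tt
  3*[h+2]^[h+1]≤[h+10]*[h+9]*h^h 1 = ≤ᵇ⇒≤ _ _ tt
  3*[h+2]^[h+1]≤[h+10]*[h+9]*h^h 2 = ≤ᵇ⇒≤ _ _ tt
  3*[h+2]^[h+1]≤[h+10]*[h+9]*h^h 3 = ≤ᵇ⇒≤ _ _ tt
  3*[h+2]^[h+1]≤[h+10]*[h+9]*h^h 4 = ≤ᵇ⇒≤ _ _ tt
  3*[h+2]^[h+1]≤[h+10]*[h+9]*h^h 5 = ≤ᵇ⇒≤ _ _ tt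
  3*[h+2]^[h+1]≤[h+10]*[h+9]*h^h 6 = ≤ᵇ⇒≤ _ _ tt
  3*[h+2]^[h+1]≤[h+10]*[h+9]*h^h t@(suc (suc (suc (suc (suc (suc (suc s))))))) = begin
    3 * (n * n ^ h)                           ≤⟨ *-monoʳ-≤ 3 (*-monoʳ-≤ n ([h+2]^h≤16*h^h t)) ⟩
    3 * (n * (16 * h ^ h))                    ≡⟨ regroup n (h ^ h) ⟩
    (48 * n) * h ^ h                          ≤⟨ *-monoˡ-≤ (h ^ h) (subst (48 * n ≤_) (sym (gap s)) (m≤m+n _ _)) ⟩
    (14 + 4 * t) * (13 + 4 * t) * h ^ h       ∎
    where
    open ≤-Reasoning
    h = 4 + 4 * t
    n = 6 + 4 * t
    regroup : ∀ n x → 3 * (n * (16 * x)) ≡ (48 * n) * x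
    regroup = solve-∀
    gap : ∀ s → (14 + 4 * (7 + s)) * (13 + 4 * (7 + s)) ≡ 48 * (6 + 4 * (7 + s)) + (90 + 140 * s + 16 * (s * s))
    gap = solve-∀

  border-step : ∀ m d F → 3 ≤ m → m * (d * d) ≤ 3 * (F * F) → (9 + m) * (d * d) ≤ 3 * ((d + F) * (d + F))
  border-step m d F m≥3 bound = begin
    (9 + m) * (d * d)                         ≡⟨ split m d ⟩
    m * (d * d) + 6 * (d * d) + 3 * (d * d)  ≤⟨ +-monoˡ-≤ (3 * (d * d)) (+-mono-≤ bound (*-monoʳ-≤ 6 dd≤dF)) ⟩
    3 * (F * F) + 6 * (d * F) + 3 * (d * d)  ≡⟨ square d F ⟩
    3 * ((d + F) * (d + F))                   ∎
    where
    open ≤-Reasoning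
    d≤F : d ≤ F
    d≤F = m*m≤n*n⇒m≤n d F (*-cancelˡ-≤ 3 (≤-trans (*-monoˡ-≤ (d * d) m≥3) bound))
    dd≤dF : d * d ≤ d * F
    dd≤dF = *-monoʳ-≤ d d≤F
    split : ∀ m d → (9 + m) * (d * d) ≡ m * (d * d) + 6 * (d * d) + 3 * (d * d)
    split = solve-∀
    square : ∀ d F → 3 * (F * F) + 6 * (d * F) + 3 * (d * d) ≡ 3 * ((d + F) * (d + F))
    square = solve-∀

  hadamard-minor-estimate : ∀ m d x → d * d ≡ (2 + m) ^ (2 + m) → d ≤ (2 + m) * x →
                            (1 + m) ^ (1 + m) ≤ 3 * (1 + m) * (x * x)
  hadamard-minor-estimate m d x d²≡h^h d≤h*x = begin
    n * n ^ m        ≤⟨ *-monoʳ-≤ n (^-monoˡ-≤ m (n≤1+n n)) ⟩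
    n * h ^ m        ≤⟨ *-monoʳ-≤ n h^m≤x² ⟩
    n * (x * x)      ≤⟨ *-monoˡ-≤ (x * x) (m≤n*m n 3) ⟩
    3 * n * (x * x)  ∎
    where
    open ≤-Reasoning
    n = 1 + m
    h = 2 + m
    regroup : ∀ h x → (h * x) * (h * x) ≡ h * h * (x * x)
    regroup = solve-∀
    h^m≤x² : h ^ m ≤ x * x
    h^m≤x² = *-cancelˡ-≤ (h * h) (begin
      h * h * h ^ m      ≡⟨ *-assoc h h (h ^ m) ⟩
      h ^ h              ≡⟨ d²≡h^h ⟨
      d * d              ≤⟨ *-mono-≤ d≤h*x d≤h*x ⟩
      (h * x) * (h * x)  ≡⟨ regroup h x ⟩
      h * h * (x * x)    ∎)

  hadamard-border-estimate : ∀ h d e → d * d ≡ h ^ h → suc h ^ h ≤ 4 * h ^ h →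
                             (9 + h) * (d * d) ≤ 3 * (e * e) → suc h ^ suc h ≤ 3 * suc h * (e * e)
  hadamard-border-estimate h d e d²≡h^h [h+1]^h≤4h^h growth = begin
    n * n ^ h                ≤⟨ *-monoʳ-≤ n [h+1]^h≤4h^h ⟩
    n * (4 * h ^ h)          ≤⟨ *-monoʳ-≤ n (*-monoˡ-≤ (h ^ h) (m≤m+n 4 (5 + h))) ⟩
    n * ((9 + h) * h ^ h)    ≡⟨ cong (λ x → n * ((9 + h) * x)) d²≡h^h ⟨
    n * ((9 + h) * (d * d))  ≤⟨ *-monoʳ-≤ n growth ⟩
    n * (3 * (e * e))        ≡⟨ regroup n (e * e) ⟩
    3 * n * (e * e)          ∎
    where
    open ≤-Reasoning
    n = suc h
    regroup : ∀ n x → n * (3 * x) ≡ 3 * n * x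
    regroup = solve-∀

  hadamard-border²-estimate : ∀ h d e₁ e₂ → d * d ≡ h ^ h →
    3 * (2 + h) ^ (1 + h) ≤ (10 + h) * (9 + h) * h ^ h →
    (9 + h) * (d * d) ≤ 3 * (e₁ * e₁) → (9 + suc h) * (e₁ * e₁) ≤ 3 * (e₂ * e₂) →
    (2 + h) ^ (2 + h) ≤ 3 * (2 + h) * (e₂ * e₂)
  hadamard-border²-estimate h d e₁ e₂ d²≡h^h estimate growth₁ growth₂ = begin
    n * n ^ (1 + h)      ≤⟨ *-monoʳ-≤ n (*-cancelˡ-≤ {m = n ^ (1 + h)} {n = 3 * (e₂ * e₂)} 3 nine) ⟩
    n * (3 * (e₂ * e₂))  ≡⟨ regroup₀ n (e₂ * e₂) ⟩
    3 * n * (e₂ * e₂)    ∎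
    where
    open ≤-Reasoning
    n = 2 + h
    regroup₀ : ∀ n x → n * (3 * x) ≡ 3 * n * x
    regroup₀ = solve-∀
    regroup₁ : ∀ a b x → a * b * x ≡ a * (b * x)
    regroup₁ = solve-∀
    regroup₂ : ∀ a y → a * (3 * y) ≡ 3 * (a * y)
    regroup₂ = solve-∀
    nine : 3 * n ^ (1 + h) ≤ 3 * (3 * (e₂ * e₂))
    nine = begin
      3 * n ^ (1 + h)                  ≤⟨ estimate ⟩
      (10 + h) * (9 + h) * h ^ h       ≡⟨ cong ((10 + h) * (9 + h) *_) d²≡h^h ⟨
      (10 + h) * (9 + h) * (d * d)     ≡⟨ regroup₁ (10 + h) (9 + h) (d * d) ⟩
      (10 + h) * ((9 + h) * (d * d))   ≤⟨ *-monoʳ-≤ (10 + h) growth₁ ⟩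
      (10 + h) * (3 * (e₁ * e₁))       ≡⟨ regroup₂ (10 + h) (e₁ * e₁) ⟩
      3 * ((9 + suc h) * (e₁ * e₁))    ≤⟨ *-monoʳ-≤ 3 growth₂ ⟩
      3 * (3 * (e₂ * e₂))              ∎

module HadamardOrders where

  open import Data.Nat
  open import Data.Nat.Properties
  open import Data.Nat.Tactic.RingSolver using (solve-∀)
  open import Data.Fin using (zero; suc; punchIn; toℕ)
  open import Data.Integer as ℤ using (ℤ; +_; -[1+_]; ∣_∣; +≤+; 1ℤ; -1ℤ)
  open import Data.Product using (Σ; _×_; _,_)
  open import Data.Sum using (inj₁; inj₂)
  open import Data.Unit using (tt)
  open import Relation.Binary.PropositionalEquality
  open Sums
  open Determinants
  open Inequalities using (∑ℕ≤n*max)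
  open Bordering
  open Estimates

  x^2≡x*x : ∀ x → x ^ 2 ≡ x * x
  x^2≡x*x x = cong (x *_) (*-identityʳ x)

  -- Laplace expansion along row 0 gives ∣ det H ∣ ≤ ∑ⱼ ∣ det (minor H j) ∣.
  opaque
    minor-bound : ∀ {k} (H : Matrix (suc k)) → IsPM1 H →
                  Σ (Matrix k) λ M → IsPM1 M × (∣ det H ∣ ≤ suc k * ∣ det M ∣)
    minor-bound {k} H H-pm with ∑ℕ≤n*max k (λ j → ∣ det (minor H j) ∣)
    ... | j , ∑≤max = minor H j , (λ r c → H-pm (suc r) (punchIn j c)) , (begin
      ∣ det H ∣                                   ≡⟨ cong ∣_∣ (det-laplace H) ⟩
      ∣ ∑ (suc k) (laplaceTerm H) ∣               ≤⟨ ∣∑∣≤∑ℕ∣∣ (suc k) (laplaceTerm H) ⟩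
      ∑ℕ (suc k) (λ i → ∣ laplaceTerm H i ∣)      ≡⟨ ∑ℕ-cong (suc k) ∣laplaceTerm∣ ⟩
      ∑ℕ (suc k) (λ i → ∣ det (minor H i) ∣)      ≤⟨ ∑≤max ⟩
      suc k * ∣ det (minor H j) ∣                 ∎)
      where
      open ≤-Reasoning
      ∣laplaceTerm∣ : ∀ i → ∣ laplaceTerm H i ∣ ≡ ∣ det (minor H i) ∣
      ∣laplaceTerm∣ i = trans (cong ∣_∣ (laplaceTerm-def H i))
        (trans (∣sign*x∣≡∣x∣ (sgn-isSign (toℕ i)) _) (∣sign*x∣≡∣x∣ (H-pm zero i) _))

  RLowerBound-witness : ∀ {n} (M : Matrix n) {d} → IsPM1 M → det M ≡ + d →
                        n ^ n ≤ 3 * n * (d * d) → RLowerBound n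
  RLowerBound-witness {n} M {d} M-pm det≡ bound =
    M , M-pm , subst (+ 0 ℤ.≤_) (sym det≡) (+≤+ z≤n) ,
    subst (λ x → n ^ n ≤ 3 * n * x) (sym (trans (cong (λ x → ∣ x ∣ ^ 2) det≡) (x^2≡x*x d))) bound

  -- Negating row 0 if necessary makes the determinant nonnegative.
  RLowerBound-witness-∣det∣ : ∀ {k} (M : Matrix (suc k)) → IsPM1 M →
               suc k ^ suc k ≤ 3 * suc k * (∣ det M ∣ * ∣ det M ∣) → RLowerBound (suc k)
  RLowerBound-witness-∣det∣ M M-pm bound with det M in det≡
  ... | + d      = RLowerBound-witness M M-pm det≡ bound
  ... | -[1+ d ] = RLowerBound-witness (negateRow₀ M) negated-isPM1
                                       (trans (det-negateRow₀ M) (cong ℤ.-_ det≡)) bound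
    where
    negated-isPM1 : IsPM1 (negateRow₀ M)
    negated-isPM1 zero    j with M-pm zero j
    ... | inj₁ M₀ⱼ≡1  = inj₂ (cong ℤ.-_ M₀ⱼ≡1)
    ... | inj₂ M₀ⱼ≡-1 = inj₁ (cong ℤ.-_ M₀ⱼ≡-1)
    negated-isPM1 (suc i) j = M-pm (suc i) j

  ∣det∣²≡ : ∀ {h} (H : Matrix h) → IsHadamard H → ∣ det H ∣ * ∣ det H ∣ ≡ h ^ h
  ∣det∣²≡ H (_ , ∣det∣^2≡) = trans (sym (x^2≡x*x ∣ det H ∣)) ∣det∣^2≡

  bordering-growth : ∀ {k} (N : Matrix (suc k)) → IsPM1 N → 3 ≤ suc k →
    Σ (Matrix (suc (suc k))) λ P → IsPM1 P ×
      ((9 + suc k) * (∣ det N ∣ * ∣ det N ∣) ≤ 3 * (∣ det P ∣ * ∣ det P ∣))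
  bordering-growth {k} N N-pm k≥3 =
    let P , P-pm , F , ∣detP∣≡ , bound = bordering N N-pm
    in P , P-pm , subst (λ x → (9 + suc k) * (∣ det N ∣ * ∣ det N ∣) ≤ 3 * (x * x)) (sym ∣detP∣≡)
                        (border-step (suc k) ∣ det N ∣ F k≥3 bound)

  hadamard-bound : ∀ {k} (H : Matrix (suc k)) → IsHadamard H → RLowerBound (suc k)
  hadamard-bound {k} H H-had@(H-pm , _) =
    RLowerBound-witness-∣det∣ H H-pm (subst (λ x → suc k ^ suc k ≤ 3 * suc k * x) (sym (∣det∣²≡ H H-had))
                             (m≤n*m (suc k ^ suc k) (3 * suc k)))

  hadamard-minor-bound : ∀ {m} (H : Matrix (suc (suc m))) → IsHadamard H → RLowerBound (suc m)
  hadamard-minor-bound {m} H H-had@(H-pm , _) =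
    let M , M-pm , d≤h*x = minor-bound H H-pm
    in RLowerBound-witness-∣det∣ M M-pm (hadamard-minor-estimate m (∣ det H ∣) (∣ det M ∣) (∣det∣²≡ H H-had) d≤h*x)

  hadamard-border-bound : ∀ {k} (H : Matrix (suc k)) → IsHadamard H → 3 ≤ suc k →
                          suc (suc k) ^ suc k ≤ 4 * suc k ^ suc k → RLowerBound (suc (suc k))
  hadamard-border-bound {k} H H-had@(H-pm , _) k≥3 [h+1]^h≤4h^h =
    let P , P-pm , growth = bordering-growth H H-pm k≥3
    in RLowerBound-witness-∣det∣ P P-pm (hadamard-border-estimate (suc k) (∣ det H ∣) (∣ det P ∣)
                                                   (∣det∣²≡ H H-had) [h+1]^h≤4h^h growth)

  hadamard-border²-bound : ∀ {k} (H : Matrix (suc k)) → IsHadamard H → 3 ≤ suc k →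
    3 * (2 + suc k) ^ (1 + suc k) ≤ (10 + suc k) * (9 + suc k) * suc k ^ suc k → RLowerBound (2 + suc k)
  hadamard-border²-bound {k} H H-had@(H-pm , _) k≥3 estimate =
    let P₁ , P₁-pm , growth₁ = bordering-growth H H-pm k≥3
        P₂ , P₂-pm , growth₂ = bordering-growth P₁ P₁-pm (≤-trans k≥3 (n≤1+n (suc k)))
    in RLowerBound-witness-∣det∣ P₂ P₂-pm (hadamard-border²-estimate (suc k) (∣ det H ∣) (∣ det P₁ ∣) (∣ det P₂ ∣)
                                                      (∣det∣²≡ H H-had) estimate growth₁ growth₂)

  order-one-bound : RLowerBound 1
  order-one-bound = RLowerBound-witness (λ _ _ → 1ℤ) (λ _ _ → inj₁ refl) refl (s≤s z≤n)

  order-two-bound : RLowerBound 2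
  order-two-bound = RLowerBound-witness two-by-two two-by-two-isPM1 refl (≤ᵇ⇒≤ _ _ tt)
    where
    two-by-two : Matrix 2
    two-by-two zero    zero    = 1ℤ
    two-by-two zero    (suc _) = -1ℤ
    two-by-two (suc _) _       = 1ℤ
    two-by-two-isPM1 : IsPM1 two-by-two
    two-by-two-isPM1 zero    zero    = inj₁ refl
    two-by-two-isPM1 zero    (suc _) = inj₂ refl
    two-by-two-isPM1 (suc _) _       = inj₁ refl

  hadamard-of-order : HadamardConjecture → ∀ t → Σ (Matrix (4 + 4 * t)) IsHadamard
  hadamard-of-order hadamard-conjecture t =
    subst (λ h → Σ (Matrix h) IsHadamard) (quadruple t) (hadamard-conjecture (suc t) (s≤s z≤n))
    where
    quadruple : ∀ t → 4 * suc t ≡ 4 + 4 * t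
    quadruple = solve-∀

  data Order : ℕ → Set where
    one    : Order 1
    two    : Order 2
    below  : ∀ t → Order (3 + 4 * t)
    at     : ∀ t → Order (4 + 4 * t)
    above₁ : ∀ t → Order (5 + 4 * t)
    above₂ : ∀ t → Order (6 + 4 * t)

  order : ∀ n → Order (suc n)
  order zero    = one
  order (suc n) = next (order n)
    where
    next : ∀ {m} → Order m → Order (suc m)
    next one        = two
    next two        = below 0
    next (below t)  = at t
    next (at t)     = above₁ t
    next (above₁ t) = above₂ t
    next (above₂ t) = subst Order (wrap t) (below (suc t))
      where
      wrap : ∀ t → 3 + 4 * suc t ≡ 7 + 4 * t
      wrap = solve-∀

open HadamardOrders
open Estimates using ([h+1]^h≤4*h^h; 3*[h+2]^[h+1]≤[h+10]*[h+9]*h^h)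
open import Data.Nat using (suc; s≤s; z≤n; _+_; _*_)
open import Data.Product using (_,_)

corollary4 : HadamardConjecture → (n : ℕ) → 1 ≤ n → RLowerBound n
corollary4 hadamard-conjecture (suc n) _ = bound (order n)
  where
  three≤h : ∀ t → 3 ≤ suc (3 + 4 * t)
  three≤h t = s≤s (s≤s (s≤s z≤n))
  bound : ∀ {n} → Order n → RLowerBound n
  bound one        = order-one-bound
  bound two        = order-two-bound
  bound (below t)  = let H , H-had = hadamard-of-order hadamard-conjecture t in
    hadamard-minor-bound H H-had
  bound (at t)     = let H , H-had = hadamard-of-order hadamard-conjecture t in
    hadamard-bound H H-had
  bound (above₁ t) = let H , H-had = hadamard-of-order hadamard-conjecture t in
    hadamard-border-bound H H-had (three≤h t) ([h+1]^h≤4*h^h t)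
  bound (above₂ t) = let H , H-had = hadamard-of-order hadamard-conjecture t in
    hadamard-border²-bound H H-had (three≤h t) (3*[h+2]^[h+1]≤[h+10]*[h+9]*h^h t)
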